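{- Let $w\in S_n$ be vexillary and let $A\subseteq D(w)$ contain at most one square in each column. Suppose $(i,j)\in A$ and $(i-1,j)\in D(w)$, and let $A'=(A\setminus\{(i,j)\})\cup\{(i-1,j)\}$. Then $\{D:(D,F_1,A_1)\in\mathcal{SBD}(D(w),\emptyset,A)\text{ for some }F_1,A_1\}=\{D:(D,F_2,A_2)\in\mathcal{SBD}(D(w),\emptyset,A')\text{ for some }F_2,A_2\}$. Furthermore, $D_{\mathrm{top}}(D(w),A)=D_{\mathrm{top}}(D(w),A')$.
   Context: $w$ is vexillary if it avoids $2143$. Rothe diagram $D(w)=\{(i,j)\in[n]\times[n]:i<w^{ -1}(j),\ j<w(i)\}$ (row $i$, column $j$, rows numbered top to bottom). For a diagram $D$ and $A\subseteq D$ with at most one square per column, $D_{\mathrm{top}}(D,A)=D\cup\{(i,j):(i',j)\in A\text{ for some }i'>i\}$. A dead square diagram is a triple $(D,F,A)$ with $D$ a diagram, $F\subseteq D$, $A\subseteq D\setminus F$, such that for every $(i,j)\in F$ there is $(i',j)\in A$ with $i'<i$ and no $(i'',j)\in D\setminus F$ with $i'<i''<i$. If $(i,j)\in D\setminus F$ and $(i-1,j)\notin D$, a bubbling move yields $(D\setminus\{(i,j)\}\cup\{(i-1,j)\},F,A'')$ with $A''=A$ if $(i,j)\notin A$ and $A''=A\setminus\{(i,j)\}\cup\{(i-1,j)\}$ otherwise. If $(i,j)\in A$ and $(i-1,j)\notin D$, a K-bubbling move yields $(D\cup\{(i-1,j)\},F\cup\{(i,j)\},A\setminus\{(i,j)\}\cup\{(i-1,j)\})$.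 $\mathcal{SBD}(D,F,A)$ is the set of dead square diagrams obtainable from $(D,F,A)$ by finitely many (possibly zero) such moves. -}

module Defs where

open import Data.Nat using (ℕ; suc)
open import Data.Bool using (Bool; true; false; if_then_else_; _∧_)
open import Data.Fin using (Fin; toℕ; _<_; _≟_; _<?_)
open import Data.Fin.Permutation using (Permutation′; _⟨$⟩ʳ_; _⟨$⟩ˡ_)
open import Data.Product using (Σ; ∃; _×_; _,_; proj₁)
open import Data.Sum using (_⊎_)
open import Relation.Nullary using (¬_)
open import Relation.Nullary.Decidable using (⌊_⌋)
open import Relation.Binary.PropositionalEquality using (_≡_)
open import Function.Bundles using (_⇔_)

-- Squares are (row , column), rows and columns 0-indexed in Fin n
-- (row 0 is the top row).  A diagram (subset of [n]×[n]) is a Boolean matrix.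
Diagram : ℕ → Set
Diagram n = Fin n → Fin n → Bool

module _ {n : ℕ} where

  _∈D_ : Fin n × Fin n → Diagram n → Set
  (i , j) ∈D D = D i j ≡ true

  _∉D_ : Fin n × Fin n → Diagram n → Set
  p ∉D D = ¬ (p ∈D D)

  _⊆D_ : Diagram n → Diagram n → Set
  X ⊆D Y = ∀ i j → (i , j) ∈D X → (i , j) ∈D Y

  emptyD : Diagram n
  emptyD _ _ = false

  sameSq : Fin n × Fin n → Fin n → Fin n → Bool
  sameSq (i , j) k l = ⌊ k ≟ i ⌋ ∧ ⌊ l ≟ j ⌋

  addSq : Fin n × Fin n → Diagram n → Diagram n
  addSq p X k l = if sameSq p k l then true else X k l

  removeSq : Fin n × Fin n → Diagram n → Diagram n
  removeSq p X k l = if sameSq p k l then false else X k l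

  replaceSq : Fin n × Fin n → Fin n × Fin n → Diagram n → Diagram n
  replaceSq p q X = addSq q (removeSq p X)

  AtMostOnePerColumn : Diagram n → Set
  AtMostOnePerColumn A = ∀ i i' j → (i , j) ∈D A → (i' , j) ∈D A → i ≡ i'

  rothe : Permutation′ n → Diagram n
  rothe w i j = ⌊ i <? (w ⟨$⟩ˡ j) ⌋ ∧ ⌊ j <? (w ⟨$⟩ʳ i) ⌋

  Vexillary : Permutation′ n → Set
  Vexillary w = ¬ (Σ (Fin n) λ a → Σ (Fin n) λ b → Σ (Fin n) λ c → Σ (Fin n) λ d →
      a < b × b < c × c < d ×
      (w ⟨$⟩ʳ b) < (w ⟨$⟩ʳ a) × (w ⟨$⟩ʳ a) < (w ⟨$⟩ʳ d) × (w ⟨$⟩ʳ d) < (w ⟨$⟩ʳ c))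

  InDtop : Diagram n → Diagram n → Fin n → Fin n → Set
  InDtop D A i j = ((i , j) ∈D D) ⊎ (Σ (Fin n) λ i' → i < i' × (i' , j) ∈D A)

  record Triple : Set where
    constructor ⟨_,_,_⟩
    field
      diag : Diagram n
      dead : Diagram n
      anch : Diagram n
  open Triple public

  IsDSD : Triple → Set
  IsDSD ⟨ D , F , A ⟩ =
      (F ⊆D D)
    × (∀ i j → (i , j) ∈D A → (i , j) ∈D D × (i , j) ∉D F)
    × (∀ i j → (i , j) ∈D F →
         Σ (Fin n) λ i' → i' < i × (i' , j) ∈D A ×
           (∀ i'' → i' < i'' → i'' < i → ¬ ((i'' , j) ∈D D × (i'' , j) ∉D F)))

  data Step : Triple → Triple → Set where
    bubble : ∀ {D F A} (r r' j : Fin n) → toℕ r ≡ suc (toℕ r') →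
      IsDSD ⟨ D , F , A ⟩ →
      (r , j) ∈D D → (r , j) ∉D F → (r' , j) ∉D D →
      Step ⟨ D , F , A ⟩
           ⟨ replaceSq (r , j) (r' , j) D , F
           , (if A r j then replaceSq (r , j) (r' , j) A else A) ⟩
    kbubble : ∀ {D F A} (r r' j : Fin n) → toℕ r ≡ suc (toℕ r') →
      IsDSD ⟨ D , F , A ⟩ →
      (r , j) ∈D A → (r' , j) ∉D D →
      Step ⟨ D , F , A ⟩
           ⟨ addSq (r' , j) D , addSq (r , j) F , replaceSq (r , j) (r' , j) A ⟩

  data Reach : Triple → Triple → Set where
    done : ∀ {T} → Reach T T
    step : ∀ {T U V} → Step T U → Reach U V → Reach T V

  InSBD : Triple → Triple → Set
  InSBD start T = Reach start T × IsDSD T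

  SBDDiagram : Triple → Diagram n → Set
  SBDDiagram start D = Σ Triple λ T → InSBD start T × (∀ i j → diag T i j ≡ D i j)

{-# OPTIONS --safe #-}
-- Moves act on a single column and the dead square condition is checked column by column, so a
-- run from (D, ∅, A) can be replayed with its column j replaced by any run of that column alone.
-- As A and A' differ only in column j, it suffices to compare the runs of column j anchored at i
-- with those anchored at i-1; both squares lie in D. Each inclusion is a simulation: the second
-- run shadows the first with the roles of the two squares exchanged, and catches up at the end.
-- The D_top claim is immediate, since the anchor only moves from (i,j) to (i-1,j) ∈ D.

module Submission where

open import Defs
open import Data.Nat using (ℕ; suc)
open import Data.Fin using (Fin; toℕ)
open import Data.Product using (_×_; _,_)
open import Relation.Binary.PropositionalEquality using (_≡_)
open import Data.Fin.Permutation using (Permutation′)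
open import Function.Bundles using (_⇔_)

open import Data.Bool using (Bool; true; false; if_then_else_)
open import Data.Bool.Properties using (¬-not; not-¬) renaming (_≟_ to _≟ᵇ_)
open import Data.Empty using (⊥; ⊥-elim)
open import Data.Fin using (suc; inject₁; _≟_; _<_; _≤_)
open import Data.Fin.Induction using (<-wellFounded)
import Data.Fin.Properties as F
open import Data.Maybe using (Maybe; just; nothing; fromMaybe)
import Data.Nat.Properties as ℕ
open import Data.Product using (Σ; proj₁; proj₂; map₂)
open import Data.Sum using (_⊎_; inj₁; inj₂)
open import Data.Vec.Functional using (Vector)
open import Function.Base using (_∘_)
open import Function.Bundles using (mk⇔)
open import Induction.WellFounded using (Acc; acc)
open import Relation.Binary.Definitions using (tri<; tri≈; tri>)
open import Relation.Binary.PropositionalEquality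
  using (_≢_; _≗_; refl; sym; trans; cong; ≢-sym; _→-setoid_)
import Relation.Binary.Reasoning.Setoid as SetoidReasoning
open import Relation.Nullary using (¬_; Dec; yes; no; contradiction)
open import Relation.Nullary.Decidable using (⌊_⌋; toSum; _×-dec_)

-- r' ⋖ r : row r' lies directly above row r (rows are numbered from the top).
_⋖_ : {n : ℕ} → Fin n → Fin n → Set
r' ⋖ r = toℕ r ≡ suc (toℕ r')

row-above : {n : ℕ} {y x : Fin n} → y < x → Σ (Fin n) (_⋖ x)
row-above {x = suc x₋} _ = inject₁ x₋ , cong suc (sym (F.toℕ-inject₁ x₋))

⋖-unique : {n : ℕ} {r' r'' r : Fin n} → r' ⋖ r → r'' ⋖ r → r' ≡ r''
⋖-unique r'⋖r r''⋖r = F.toℕ-injective (ℕ.suc-injective (trans (sym r'⋖r) r''⋖r))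

module _ {n : ℕ} {r' r : Fin n} (r'⋖r : r' ⋖ r) where

  ⋖⇒< : r' < r
  ⋖⇒< rewrite r'⋖r = ℕ.≤-refl

  ⋖⇒≢ : r ≢ r'
  ⋖⇒≢ = ≢-sym (F.<⇒≢ ⋖⇒<)

  ⋖-suc-≤ : ∀ {x : Fin n} → r' < x → r ≤ x
  ⋖-suc-≤ r'<x rewrite r'⋖r = r'<x

  ⋖-gap : ∀ {x : Fin n} → r' < x → x < r → ⊥
  ⋖-gap r'<x x<r = ℕ.<⇒≱ x<r (⋖-suc-≤ r'<x)

  ⋖-above : ∀ {x : Fin n} → r' < x → x ≢ r → r < x
  ⋖-above r'<x x≢r = F.≤∧≢⇒< (⋖-suc-≤ r'<x) (≢-sym x≢r)

  ⋖-≤-pred : ∀ {x : Fin n} → x < r → x ≤ r'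
  ⋖-≤-pred x<r = ℕ.≤-pred (ℕ.≤-trans x<r (ℕ.≤-reflexive r'⋖r))

  ⋖-below : ∀ {x : Fin n} → x < r → x ≢ r' → x < r'
  ⋖-below x<r = F.≤∧≢⇒< (⋖-≤-pred x<r)

module _ {n : ℕ} where

  insert erase : Fin n → Vector Bool n → Vector Bool n
  insert x g k = if ⌊ k ≟ x ⌋ then true else g k
  erase x g k = if ⌊ k ≟ x ⌋ then false else g k

  move : Fin n → Fin n → Vector Bool n → Vector Bool n
  move p q g = insert q (erase p g)

  carry : Fin n → Fin n → Vector Bool n → Vector Bool n
  carry p q g = if g p then move p q g else g

  only : Fin n → Vector Bool n
  only x k = ⌊ k ≟ x ⌋

  none : Vector Bool n
  none _ = false

  module _ (g : Vector Bool n) where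

    insert-≡ : ∀ x → insert x g x ≡ true
    insert-≡ x with x ≟ x
    ... | yes _ = refl
    ... | no x≢x = contradiction refl x≢x

    insert-≢ : ∀ {x k} → k ≢ x → insert x g k ≡ g k
    insert-≢ {x} {k} k≢x with k ≟ x
    ... | yes k≡x = contradiction k≡x k≢x
    ... | no _ = refl

    erase-≡ : ∀ x → erase x g x ≡ false
    erase-≡ x with x ≟ x
    ... | yes _ = refl
    ... | no x≢x = contradiction refl x≢x

    erase-≢ : ∀ {x k} → k ≢ x → erase x g k ≡ g k
    erase-≢ {x} {k} k≢x with k ≟ x
    ... | yes k≡x = contradiction k≡x k≢x
    ... | no _ = refl

    insert⁺ : ∀ {x k} → g k ≡ true → insert x g k ≡ true
    insert⁺ {x} {k} gk with k ≟ x
    ... | yes _ = refl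
    ... | no _ = gk

    insert⁻ : ∀ {x k} → insert x g k ≡ true → k ≡ x ⊎ g k ≡ true
    insert⁻ {x} {k} h with k ≟ x
    ... | yes k≡x = inj₁ k≡x
    ... | no _ = inj₂ h

    erase⁻ : ∀ {x k} → erase x g k ≡ true → k ≢ x × g k ≡ true
    erase⁻ {x} {k} h with k ≟ x
    ... | no k≢x = k≢x , h

    erase-false : ∀ {x k} → g k ≡ false → erase x g k ≡ false
    erase-false {x} {k} gk with k ≟ x
    ... | yes _ = refl
    ... | no _ = gk

  module _ (g : Vector Bool n) where

    move-≡ : ∀ p q → move p q g q ≡ true
    move-≡ p q = insert-≡ (erase p g) q

    move-source : ∀ {p q} → p ≢ q → move p q g p ≡ false
    move-source {p} {q} p≢q = trans (insert-≢ (erase p g) p≢q) (erase-≡ g p)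

    move-≢ : ∀ {p q k} → k ≢ p → k ≢ q → move p q g k ≡ g k
    move-≢ {p} k≢p k≢q = trans (insert-≢ (erase p g) k≢q) (erase-≢ g k≢p)

    move⁺ : ∀ {p q k} → g k ≡ true → k ≢ p → move p q g k ≡ true
    move⁺ {p} gk k≢p = insert⁺ (erase p g) (trans (erase-≢ g k≢p) gk)

    move⁻ : ∀ {p q k} → move p q g k ≡ true → k ≡ q ⊎ (k ≢ p × g k ≡ true)
    move⁻ {p} h with insert⁻ (erase p g) h
    ... | inj₁ k≡q = inj₁ k≡q
    ... | inj₂ h' = inj₂ (erase⁻ g h')

    carry-marked : ∀ {p q} → g p ≡ true → carry p q g ≗ move p q g
    carry-marked gp k rewrite gp = refl

    carry-unmarked : ∀ {p q} → g p ≡ false → carry p q g ≗ g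
    carry-unmarked gp k rewrite gp = refl

    carry-≢ : ∀ {p q k} → k ≢ p → k ≢ q → carry p q g k ≡ g k
    carry-≢ {p} k≢p k≢q with g p
    ... | true = move-≢ k≢p k≢q
    ... | false = refl

    carry⁻ : ∀ {p q k} → carry p q g k ≡ true → k ≡ q ⊎ (k ≢ p × g k ≡ true)
    carry⁻ {p} {q} {k} h with g p in gp
    ... | true = move⁻ h
    ... | false = inj₂ ((λ { refl → not-¬ gp h }) , h)

  move-only : ∀ p q → move p q (only p) ≗ only q
  move-only p q k with k ≟ q | k ≟ p
  ... | yes _ | _ = refl
  ... | no _ | yes _ = refl
  ... | no _ | no _ = refl

  move-cong : ∀ {g h} p q → g ≗ h → move p q g ≗ move p q h
  move-cong {g} {h} p q g≗h k with k ≟ q | k ≟ p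
  ... | yes _ | _ = refl
  ... | no _ | yes _ = refl
  ... | no _ | no _ = g≗h k

  insert-cong : ∀ {g h} x → g ≗ h → insert x g ≗ insert x h
  insert-cong x g≗h k with k ≟ x
  ... | yes _ = refl
  ... | no _ = g≗h k

  carry-cong : ∀ {g h} p q → g ≗ h → carry p q g ≗ carry p q h
  carry-cong {g} {h} p q g≗h k rewrite g≗h p with h p
  ... | true = move-cong p q g≗h k
  ... | false = g≗h k

  move-self : ∀ {x} g → g x ≡ true → move x x g ≗ g
  move-self {x} g gx k with k ≟ x
  ... | yes refl = sym gx
  ... | no _ = refl

  move-move : ∀ {p q r} g → g q ≡ false → move q r (move p q g) ≗ move p r g
  move-move {p} {q} {r} g gq k with k ≟ r
  ... | yes _ = refl
  ... | no _ with k ≟ q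
  ...   | no _ = refl
  ...   | yes refl with k ≟ p
  ...     | yes _ = refl
  ...     | no _ = sym gq

  move-insert-comm : ∀ {p q x} g → x ≢ p → x ≢ q → move p q (insert x g) ≗ insert x (move p q g)
  move-insert-comm {p} {q} {x} g x≢p x≢q k with k ≟ q | k ≟ p | k ≟ x
  ... | yes _ | _ | yes _ = refl
  ... | yes _ | _ | no _ = refl
  ... | no _ | yes refl | yes refl = contradiction refl x≢p
  ... | no _ | yes _ | no _ = refl
  ... | no _ | no _ | yes _ = refl
  ... | no _ | no _ | no _ = refl

  move-erase-comm : ∀ {p q x} g → x ≢ p → x ≢ q → move p q (erase x g) ≗ erase x (move p q g)
  move-erase-comm {p} {q} {x} g x≢p x≢q k with k ≟ q | k ≟ p | k ≟ x
  ... | yes refl | _ | yes refl = contradiction refl x≢q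
  ... | yes _ | _ | no _ = refl
  ... | no _ | yes refl | yes refl = contradiction refl x≢p
  ... | no _ | yes _ | no _ = refl
  ... | no _ | no _ | yes _ = refl
  ... | no _ | no _ | no _ = refl

  insert-erase-comm : ∀ {x y} g → x ≢ y → insert x (erase y g) ≗ erase y (insert x g)
  insert-erase-comm {x} {y} g x≢y k with k ≟ x | k ≟ y
  ... | yes refl | yes refl = contradiction refl x≢y
  ... | yes _ | no _ = refl
  ... | no _ | yes _ = refl
  ... | no _ | no _ = refl

  move-insert-source : ∀ {p q} g → move p q (insert p g) ≗ move p q g
  move-insert-source {p} {q} g k with k ≟ q
  ... | yes _ = refl
  ... | no _ with k ≟ p
  ...   | yes _ = refl
  ...   | no _ = refl

  erase-absent : ∀ {x} g → g x ≡ false → erase x g ≗ g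
  erase-absent {x} g gx k with k ≟ x
  ... | yes refl = sym gx
  ... | no _ = refl

  erase-move : ∀ {p q} g → g q ≡ false → erase q (move p q g) ≗ erase p g
  erase-move {p} {q} g gq k with k ≟ q
  ... | no _ = refl
  ... | yes refl with k ≟ p
  ...   | yes _ = refl
  ...   | no _ = sym gq

  erase-insert : ∀ {x} g → g x ≡ false → erase x (insert x g) ≗ g
  erase-insert {x} g gx k with k ≟ x
  ... | yes refl = sym gx
  ... | no _ = refl

  only-≡ : ∀ x → only x x ≡ true
  only-≡ x with x ≟ x
  ... | yes _ = refl
  ... | no x≢x = contradiction refl x≢x

  only⁻ : ∀ {x k} → only x k ≡ true → k ≡ x
  only⁻ {x} {k} h with k ≟ x
  ... | yes k≡x = k≡x

  only-≢ : ∀ {x k} → k ≢ x → only x k ≡ false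
  only-≢ {x} {k} k≢x with k ≟ x
  ... | yes k≡x = contradiction k≡x k≢x
  ... | no _ = refl

  move-erase-target : ∀ {p q} g → g q ≡ true → (q ≢ p → g p ≡ false) → move p q (erase q g) ≗ g
  move-erase-target {p} {q} g gq gp k with k ≟ q
  ... | yes refl = sym gq
  ... | no k≢q with k ≟ p
  ...   | yes refl = sym (gp (≢-sym k≢q))
  ...   | no _ = refl

  erase-cong : ∀ {g h} x → g ≗ h → erase x g ≗ erase x h
  erase-cong x g≗h k with k ≟ x
  ... | yes _ = refl
  ... | no _ = g≗h k

-- Columns

module _ {n : ℕ} where

  record Column : Set where
    constructor ⟪_,_,_⟫
    field
      diagᶜ deadᶜ anchᶜ : Vector Bool n
  open Column public

  _≈ᶜ_ : Column → Column → Set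
  C ≈ᶜ D = diagᶜ C ≗ diagᶜ D × deadᶜ C ≗ deadᶜ D × anchᶜ C ≗ anchᶜ D

  ≈ᶜ-refl : ∀ {C} → C ≈ᶜ C
  ≈ᶜ-refl = (λ _ → refl) , (λ _ → refl) , (λ _ → refl)

  ≈ᶜ-sym : ∀ {C D} → C ≈ᶜ D → D ≈ᶜ C
  ≈ᶜ-sym (d , f , a) = sym ∘ d , sym ∘ f , sym ∘ a

  ≈ᶜ-trans : ∀ {C D E} → C ≈ᶜ D → D ≈ᶜ E → C ≈ᶜ E
  ≈ᶜ-trans (d , f , a) (d' , f' , a') =
    (λ k → trans (d k) (d' k)) , (λ k → trans (f k) (f' k)) , (λ k → trans (a k) (a' k))

  bubbled kbubbled : Fin n → Fin n → Column → Column
  bubbled r r' C = ⟪ move r r' (diagᶜ C) , deadᶜ C , carry r r' (anchᶜ C) ⟫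
  kbubbled r r' C = ⟪ insert r' (diagᶜ C) , insert r (deadᶜ C) , move r r' (anchᶜ C) ⟫

  -- Unlike Step, a column move has no dead-square precondition (Stepᶜ-preserves-DSD makes it
  -- redundant along runs), and its target is only fixed up to ≈ᶜ.
  data Stepᶜ (C C' : Column) : Set where
    bubbleᶜ : (r r' : Fin n) → r' ⋖ r →
      diagᶜ C r ≡ true → deadᶜ C r ≡ false → diagᶜ C r' ≡ false →
      C' ≈ᶜ bubbled r r' C → Stepᶜ C C'
    kbubbleᶜ : (r r' : Fin n) → r' ⋖ r →
      anchᶜ C r ≡ true → diagᶜ C r' ≡ false →
      C' ≈ᶜ kbubbled r r' C → Stepᶜ C C'

  data Reachᶜ : Column → Column → Set where
    doneᶜ : ∀ {C D} → C ≈ᶜ D → Reachᶜ C D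
    stepᶜ : ∀ {C D E} → Stepᶜ C D → Reachᶜ D E → Reachᶜ C E

  Stepᶜ-respˡ : ∀ {C C' D} → C ≈ᶜ C' → Stepᶜ C D → Stepᶜ C' D
  Stepᶜ-respˡ (d , f , a) (bubbleᶜ r r' r'⋖r dr fr dr' D≈) =
    bubbleᶜ r r' r'⋖r (trans (sym (d r)) dr) (trans (sym (f r)) fr) (trans (sym (d r')) dr')
      (≈ᶜ-trans D≈ (move-cong r r' d , f , carry-cong r r' a))
  Stepᶜ-respˡ (d , f , a) (kbubbleᶜ r r' r'⋖r ar dr' D≈) =
    kbubbleᶜ r r' r'⋖r (trans (sym (a r)) ar) (trans (sym (d r')) dr')
      (≈ᶜ-trans D≈ (insert-cong r' d , insert-cong r f , move-cong r r' a))

  Reachᶜ-respˡ : ∀ {C C' D} → C ≈ᶜ C' → Reachᶜ C D → Reachᶜ C' D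
  Reachᶜ-respˡ C≈ (doneᶜ C≈D) = doneᶜ (≈ᶜ-trans (≈ᶜ-sym C≈) C≈D)
  Reachᶜ-respˡ C≈ (stepᶜ s R) = stepᶜ (Stepᶜ-respˡ C≈ s) R

  Reachᶜ-respʳ : ∀ {C D D'} → Reachᶜ C D → D ≈ᶜ D' → Reachᶜ C D'
  Reachᶜ-respʳ (doneᶜ C≈D) D≈D' = doneᶜ (≈ᶜ-trans C≈D D≈D')
  Reachᶜ-respʳ (stepᶜ s R) D≈D' = stepᶜ s (Reachᶜ-respʳ R D≈D')

  Stepᶜ⇒Reachᶜ : ∀ {C D} → Stepᶜ C D → Reachᶜ C D
  Stepᶜ⇒Reachᶜ s = stepᶜ s (doneᶜ ≈ᶜ-refl)

  _◅◅ᶜ_ : ∀ {C D E} → Reachᶜ C D → Reachᶜ D E → Reachᶜ C E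
  doneᶜ C≈D ◅◅ᶜ R = Reachᶜ-respˡ (≈ᶜ-sym C≈D) R
  stepᶜ s R ◅◅ᶜ R' = stepᶜ s (R ◅◅ᶜ R')

  Live : Column → Fin n → Set
  Live C k = diagᶜ C k ≡ true × deadᶜ C k ≢ true

  record IsDSDᶜ (C : Column) : Set where
    field
      dead⊆diag : ∀ k → deadᶜ C k ≡ true → diagᶜ C k ≡ true
      anch-live : ∀ k → anchᶜ C k ≡ true → Live C k
      dead-guarded : ∀ k → deadᶜ C k ≡ true → Σ (Fin n) λ k' →
        k' < k × anchᶜ C k' ≡ true × (∀ x → k' < x → x < k → ¬ Live C x)

  IsDSDᶜ-resp : ∀ {C D} → C ≈ᶜ D → IsDSDᶜ C → IsDSDᶜ D
  IsDSDᶜ-resp {C} {D} (d , f , a) dsd = record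
    { dead⊆diag = λ k fk → trans (sym (d k)) (dead⊆diag k (trans (f k) fk))
    ; anch-live = λ k ak → live (anch-live k (trans (a k) ak))
    ; dead-guarded = λ k fk → let (k' , k'<k , ak' , between) = dead-guarded k (trans (f k) fk)
                             in k' , k'<k , trans (sym (a k')) ak' , λ x p q → between x p q ∘ unlive
    }
    where
    open IsDSDᶜ dsd
    live : ∀ {k} → Live C k → Live D k
    live {k} (dk , ¬fk) = trans (sym (d k)) dk , ¬fk ∘ trans (f k)
    unlive : ∀ {k} → Live D k → Live C k
    unlive {k} (dk , ¬fk) = trans (d k) dk , ¬fk ∘ trans (sym (f k))

  -- A dead square stays guarded when the square at r moves up to r': an anchor at r moves along,
  -- and r' cannot lie strictly between the dead square and its anchor, as r would too.
  module _ {C C' : Column} {r r' : Fin n} (r'⋖r : r' ⋖ r)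
           (live⁻ : ∀ x → Live C' x → x ≡ r' ⊎ (x ≢ r × Live C x)) where

    guard-moved : ∀ {k : Fin n} → (∀ x → r < x → x < k → ¬ Live C x) → ∀ x → r' < x → x < k → ¬ Live C' x
    guard-moved between x r'<x x<k live' with live⁻ x live'
    ... | inj₁ refl = F.<-irrefl refl r'<x
    ... | inj₂ (x≢r , live) = between x (⋖-above r'⋖r r'<x x≢r) x<k live

    guard-kept : ∀ {k k' : Fin n} → Live C r → r ≢ k →
      (∀ x → k' < x → x < k → ¬ Live C x) → ∀ x → k' < x → x < k → ¬ Live C' x
    guard-kept live-r r≢k between x k'<x x<k live' with live⁻ x live'
    ... | inj₁ refl = between r (F.<-trans k'<x (⋖⇒< r'⋖r)) (F.≤∧≢⇒< (⋖-suc-≤ r'⋖r x<k) r≢k) live-r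
    ... | inj₂ (_ , live) = between x k'<x x<k live

    guard-after-move : IsDSDᶜ C → Live C r → diagᶜ C r' ≡ false →
      (anchᶜ C r ≡ true → anchᶜ C' r' ≡ true) →
      (∀ k' → k' ≢ r → k' ≢ r' → anchᶜ C k' ≡ true → anchᶜ C' k' ≡ true) →
      ∀ k → r ≢ k → deadᶜ C k ≡ true →
      Σ (Fin n) λ k' → k' < k × anchᶜ C' k' ≡ true × (∀ x → k' < x → x < k → ¬ Live C' x)
    guard-after-move dsd live-r dr' anch-r' anch-kept k r≢k fk with IsDSDᶜ.dead-guarded dsd k fk
    ... | k' , k'<k , ak' , between with k' ≟ r
    ...   | yes refl = r' , F.<-trans (⋖⇒< r'⋖r) k'<k , anch-r' ak' , guard-moved between
    ...   | no k'≢r = k' , k'<k , anch-kept k' k'≢r k'≢r' ak' , guard-kept live-r r≢k between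
      where
      k'≢r' : k' ≢ r'
      k'≢r' refl = not-¬ dr' (proj₁ (IsDSDᶜ.anch-live dsd k' ak'))

  bubble-preserves-DSD : ∀ {C r r'} → IsDSDᶜ C → r' ⋖ r →
    diagᶜ C r ≡ true → deadᶜ C r ≡ false → diagᶜ C r' ≡ false →
    IsDSDᶜ (bubbled r r' C)
  bubble-preserves-DSD {C} {r} {r'} dsd r'⋖r dr fr dr' = record
    { dead⊆diag = λ k fk → move⁺ (diagᶜ C) (dead⊆diag k fk) (r≢dead fk ∘ sym)
    ; anch-live = anch-live'
    ; dead-guarded = λ k fk →
        guard-after-move r'⋖r live⁻ dsd (dr , not-¬ fr) dr' anch-r' anch-kept k (r≢dead fk) fk
    }
    where
    open IsDSDᶜ dsd
    C' = bubbled r r' C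
    r≢dead : ∀ {k} → deadᶜ C k ≡ true → r ≢ k
    r≢dead fk refl = not-¬ fr fk
    live⁻ : ∀ x → Live C' x → x ≡ r' ⊎ (x ≢ r × Live C x)
    live⁻ x (dx , ¬fx) with move⁻ (diagᶜ C) dx
    ... | inj₁ x≡r' = inj₁ x≡r'
    ... | inj₂ (x≢r , dx') = inj₂ (x≢r , dx' , ¬fx)
    anch-r' : anchᶜ C r ≡ true → anchᶜ C' r' ≡ true
    anch-r' ar = trans (carry-marked (anchᶜ C) ar r') (move-≡ (anchᶜ C) r r')
    anch-kept : ∀ k' → k' ≢ r → k' ≢ r' → anchᶜ C k' ≡ true → anchᶜ C' k' ≡ true
    anch-kept k' k'≢r k'≢r' ak' = trans (carry-≢ (anchᶜ C) k'≢r k'≢r') ak'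
    anch-live' : ∀ k → anchᶜ C' k ≡ true → Live C' k
    anch-live' k ak' with carry⁻ (anchᶜ C) ak'
    ... | inj₁ refl = move-≡ (diagᶜ C) r r' , not-¬ dr' ∘ dead⊆diag r'
    ... | inj₂ (k≢r , ak) with anch-live k ak
    ...   | dk , ¬fk = trans (move-≢ (diagᶜ C) k≢r (λ { refl → not-¬ dr' dk })) dk , ¬fk

  kbubble-preserves-DSD : ∀ {C r r'} → IsDSDᶜ C → r' ⋖ r →
    anchᶜ C r ≡ true → diagᶜ C r' ≡ false →
    IsDSDᶜ (kbubbled r r' C)
  kbubble-preserves-DSD {C} {r} {r'} dsd r'⋖r ar dr' = record
    { dead⊆diag = dead⊆diag'
    ; anch-live = anch-live'
    ; dead-guarded = dead-guarded'
    }
    where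
    open IsDSDᶜ dsd
    C' = kbubbled r r' C
    r'≢r : r' ≢ r
    r'≢r = ≢-sym (⋖⇒≢ r'⋖r)
    live⁻ : ∀ x → Live C' x → x ≡ r' ⊎ (x ≢ r × Live C x)
    live⁻ x (dx , ¬fx) with insert⁻ (diagᶜ C) dx
    ... | inj₁ x≡r' = inj₁ x≡r'
    ... | inj₂ dx' = inj₂ (x≢r , dx' , ¬fx ∘ insert⁺ (deadᶜ C))
      where
      x≢r : x ≢ r
      x≢r refl = ¬fx (insert-≡ (deadᶜ C) r)
    dead⊆diag' : ∀ k → deadᶜ C' k ≡ true → diagᶜ C' k ≡ true
    dead⊆diag' k fk with insert⁻ (deadᶜ C) fk
    ... | inj₁ refl = insert⁺ (diagᶜ C) (proj₁ (anch-live r ar))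
    ... | inj₂ fk' = insert⁺ (diagᶜ C) (dead⊆diag k fk')
    anch-live' : ∀ k → anchᶜ C' k ≡ true → Live C' k
    anch-live' k ak' with move⁻ (anchᶜ C) {r} {r'} {k} ak'
    ... | inj₁ refl =
      insert-≡ (diagᶜ C) r' , not-¬ dr' ∘ dead⊆diag r' ∘ trans (sym (insert-≢ (deadᶜ C) r'≢r))
    ... | inj₂ (k≢r , ak) with anch-live k ak
    ...   | dk , ¬fk = insert⁺ (diagᶜ C) dk , ¬fk ∘ trans (sym (insert-≢ (deadᶜ C) k≢r))
    dead-guarded' : ∀ k → deadᶜ C' k ≡ true → Σ (Fin n) λ k' →
      k' < k × anchᶜ C' k' ≡ true × (∀ x → k' < x → x < k → ¬ Live C' x)
    dead-guarded' k fk with insert⁻ (deadᶜ C) fk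
    ... | inj₁ refl = r' , ⋖⇒< r'⋖r , move-≡ (anchᶜ C) r r' , λ x p q _ → ⋖-gap r'⋖r p q
    ... | inj₂ fk' = guard-after-move r'⋖r live⁻ dsd (anch-live r ar) dr'
          (λ _ → move-≡ (anchᶜ C) r r') (λ k' k'≢r k'≢r' ak' → trans (move-≢ (anchᶜ C) k'≢r k'≢r') ak')
          k r≢k fk'
      where
      r≢k : r ≢ k
      r≢k refl = proj₂ (anch-live r ar) fk'

  Stepᶜ-preserves-DSD : ∀ {C C'} → Stepᶜ C C' → IsDSDᶜ C → IsDSDᶜ C'
  Stepᶜ-preserves-DSD (bubbleᶜ r r' r'⋖r dr fr dr' C'≈) dsd =
    IsDSDᶜ-resp (≈ᶜ-sym C'≈) (bubble-preserves-DSD dsd r'⋖r dr fr dr')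
  Stepᶜ-preserves-DSD (kbubbleᶜ r r' r'⋖r ar dr' C'≈) dsd =
    IsDSDᶜ-resp (≈ᶜ-sym C'≈) (kbubble-preserves-DSD dsd r'⋖r ar dr')

-- Triples as families of columns

module _ {n : ℕ} where

  col : Fin n → Triple {n} → Column
  col c T = ⟪ (λ k → diag T k c) , (λ k → dead T k c) , (λ k → anch T k c) ⟫

  AgreeOff : Fin n → Triple {n} → Triple {n} → Set
  AgreeOff j T U = ∀ l → l ≢ j → col l T ≈ᶜ col l U

  IsDSD⇒IsDSDᶜ : ∀ {T : Triple {n}} → IsDSD T → ∀ c → IsDSDᶜ (col c T)
  IsDSD⇒IsDSDᶜ (F⊆D , anch-live , dead-guarded) c = record
    { dead⊆diag = λ k → F⊆D k c ; anch-live = λ k → anch-live k c ; dead-guarded = λ k → dead-guarded k c }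

  IsDSDᶜ⇒IsDSD : ∀ {T : Triple {n}} → (∀ c → IsDSDᶜ (col c T)) → IsDSD T
  IsDSDᶜ⇒IsDSD dsd =
    (λ k c → IsDSDᶜ.dead⊆diag (dsd c) k) ,
    (λ k c → IsDSDᶜ.anch-live (dsd c) k) ,
    (λ k c → IsDSDᶜ.dead-guarded (dsd c) k)

  addSq-on : ∀ x c (X : Diagram n) → (λ k → addSq (x , c) X k c) ≗ insert x (λ k → X k c)
  addSq-on x c X k with k ≟ x | c ≟ c
  ... | yes _ | yes _ = refl
  ... | yes _ | no c≢c = contradiction refl c≢c
  ... | no _ | _ = refl

  addSq-off : ∀ {x c k l} (X : Diagram n) → l ≢ c → addSq (x , c) X k l ≡ X k l
  addSq-off {x} {c} {k} {l} X l≢c with k ≟ x | l ≟ c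
  ... | _ | yes l≡c = contradiction l≡c l≢c
  ... | yes _ | no _ = refl
  ... | no _ | no _ = refl

  replaceSq-on : ∀ p q c (X : Diagram n) → (λ k → replaceSq (p , c) (q , c) X k c) ≗ move p q (λ k → X k c)
  replaceSq-on p q c X k with k ≟ q | k ≟ p | c ≟ c
  ... | yes _ | _ | yes _ = refl
  ... | _ | _ | no c≢c = contradiction refl c≢c
  ... | no _ | yes _ | yes _ = refl
  ... | no _ | no _ | yes _ = refl

  replaceSq-off : ∀ {p q c k l} (X : Diagram n) → l ≢ c → replaceSq (p , c) (q , c) X k l ≡ X k l
  replaceSq-off {p} {q} {c} {k} {l} X l≢c with k ≟ q | k ≟ p | l ≟ c
  ... | _ | _ | yes l≡c = contradiction l≡c l≢c
  ... | yes _ | yes _ | no _ = refl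
  ... | yes _ | no _ | no _ = refl
  ... | no _ | yes _ | no _ = refl
  ... | no _ | no _ | no _ = refl

  replaceSq⁻ : ∀ {p q c} (X : Diagram n) {k l} → replaceSq (p , c) (q , c) X k l ≡ true →
    (k ≡ q × l ≡ c) ⊎ X k l ≡ true
  replaceSq⁻ {p} {q} {c} X {k} {l} h with toSum (l ≟ c)
  ... | inj₂ l≢c = inj₂ (trans (sym (replaceSq-off X l≢c)) h)
  ... | inj₁ refl with move⁻ (λ k → X k l) {p} {q} {k} (trans (sym (replaceSq-on p q l X k)) h)
  ...   | inj₁ k≡q = inj₁ (k≡q , refl)
  ...   | inj₂ (_ , Xkl) = inj₂ Xkl

  replaceSq⁺ : ∀ {p q c} (X : Diagram n) {k l} → X k l ≡ true → k ≢ p ⊎ l ≢ c →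
    replaceSq (p , c) (q , c) X k l ≡ true
  replaceSq⁺ X Xkl (inj₂ l≢c) = trans (replaceSq-off X l≢c) Xkl
  replaceSq⁺ {p} {q} {c} X {k} {l} Xkl (inj₁ k≢p) with toSum (l ≟ c)
  ... | inj₁ refl = trans (replaceSq-on p q l X k) (move⁺ (λ k → X k l) Xkl k≢p)
  ... | inj₂ l≢c = trans (replaceSq-off X l≢c) Xkl

  bubbleT kbubbleT : Fin n → Fin n → Fin n → Triple {n} → Triple {n}
  bubbleT r r' j T = ⟨ replaceSq (r , j) (r' , j) (diag T) , dead T
                     , (if anch T r j then replaceSq (r , j) (r' , j) (anch T) else anch T) ⟩
  kbubbleT r r' j T = ⟨ addSq (r' , j) (diag T) , addSq (r , j) (dead T) , replaceSq (r , j) (r' , j) (anch T) ⟩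

  module _ (r r' j : Fin n) (T : Triple {n}) where

    bubbleT-on : col j (bubbleT r r' j T) ≈ᶜ bubbled r r' (col j T)
    bubbleT-on = replaceSq-on r r' j (diag T) , (λ _ → refl) , anch-on
      where
      anch-on : anchᶜ (col j (bubbleT r r' j T)) ≗ carry r r' (anchᶜ (col j T))
      anch-on k with anch T r j
      ... | true = replaceSq-on r r' j (anch T) k
      ... | false = refl

    bubbleT-off : AgreeOff j T (bubbleT r r' j T)
    bubbleT-off l l≢j = (λ k → sym (replaceSq-off (diag T) l≢j)) , (λ _ → refl) , anch-off
      where
      anch-off : anchᶜ (col l T) ≗ anchᶜ (col l (bubbleT r r' j T))
      anch-off k with anch T r j
      ... | true = sym (replaceSq-off (anch T) l≢j)
      ... | false = refl

    kbubbleT-on : col j (kbubbleT r r' j T) ≈ᶜ kbubbled r r' (col j T)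
    kbubbleT-on = addSq-on r' j (diag T) , addSq-on r j (dead T) , replaceSq-on r r' j (anch T)

    kbubbleT-off : AgreeOff j T (kbubbleT r r' j T)
    kbubbleT-off l l≢j =
      (λ _ → sym (addSq-off (diag T) l≢j)) , (λ _ → sym (addSq-off (dead T) l≢j)) ,
      (λ _ → sym (replaceSq-off (anch T) l≢j))

  stepColumn : ∀ {T U : Triple {n}} → Step T U → Fin n
  stepColumn (bubble _ _ j _ _ _ _ _) = j
  stepColumn (kbubble _ _ j _ _ _ _) = j

  step-source-DSD : ∀ {T U : Triple {n}} → Step T U → IsDSD T
  step-source-DSD (bubble _ _ _ _ dsd _ _ _) = dsd
  step-source-DSD (kbubble _ _ _ _ dsd _ _) = dsd

  step-on : ∀ {T U} (s : Step T U) → Stepᶜ (col (stepColumn s) T) (col (stepColumn s) U)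
  step-on (bubble {D} {F} {A} r r' j r'⋖r _ dr ¬fr ¬dr') =
    bubbleᶜ r r' r'⋖r dr (¬-not ¬fr) (¬-not ¬dr') (bubbleT-on r r' j ⟨ D , F , A ⟩)
  step-on (kbubble {D} {F} {A} r r' j r'⋖r _ ar ¬dr') =
    kbubbleᶜ r r' r'⋖r ar (¬-not ¬dr') (kbubbleT-on r r' j ⟨ D , F , A ⟩)

  step-off : ∀ {T U} (s : Step T U) → AgreeOff (stepColumn s) T U
  step-off (bubble {D} {F} {A} r r' j _ _ _ _ _) = bubbleT-off r r' j ⟨ D , F , A ⟩
  step-off (kbubble {D} {F} {A} r r' j _ _ _ _) = kbubbleT-off r r' j ⟨ D , F , A ⟩

  step-preserves-DSD : ∀ {T U : Triple {n}} → Step T U → IsDSD U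
  step-preserves-DSD {T} {U} s = IsDSDᶜ⇒IsDSD column-DSD
    where
    source-DSD : ∀ l → IsDSDᶜ (col l T)
    source-DSD = IsDSD⇒IsDSDᶜ (step-source-DSD s)
    column-DSD : ∀ l → IsDSDᶜ (col l U)
    column-DSD l with l ≟ stepColumn s
    ... | yes refl = Stepᶜ-preserves-DSD (step-on s) (source-DSD l)
    ... | no l≢j = IsDSDᶜ-resp (step-off s l l≢j) (source-DSD l)

  reach-preserves-DSD : ∀ {T U : Triple {n}} → Reach T U → IsDSD T → IsDSD U
  reach-preserves-DSD done dsd = dsd
  reach-preserves-DSD (step s R) _ = reach-preserves-DSD R (step-preserves-DSD s)

  _◅◅_ : ∀ {T U V : Triple {n}} → Reach T U → Reach U V → Reach T V
  done ◅◅ R = R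
  step s R ◅◅ R' = step s (R ◅◅ R')

  lift-step : (j : Fin n) {X : Triple {n}} {W : Column} → Stepᶜ (col j X) W → IsDSD X →
    Σ (Triple {n}) λ X' → Step X X' × col j X' ≈ᶜ W × AgreeOff j X X'
  lift-step j {X} (bubbleᶜ r r' r'⋖r dr fr dr' W≈) dsd =
    bubbleT r r' j X , bubble r r' j r'⋖r dsd dr (not-¬ fr) (not-¬ dr') ,
    ≈ᶜ-trans (bubbleT-on r r' j X) (≈ᶜ-sym W≈) , bubbleT-off r r' j X
  lift-step j {X} (kbubbleᶜ r r' r'⋖r ar dr' W≈) dsd =
    kbubbleT r r' j X , kbubble r r' j r'⋖r dsd ar (not-¬ dr') ,
    ≈ᶜ-trans (kbubbleT-on r r' j X) (≈ᶜ-sym W≈) , kbubbleT-off r r' j X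

  AgreeOff-refl : ∀ {j} {T : Triple {n}} → AgreeOff j T T
  AgreeOff-refl _ _ = ≈ᶜ-refl

  AgreeOff-sym : ∀ {j} {T U : Triple {n}} → AgreeOff j T U → AgreeOff j U T
  AgreeOff-sym T~U l l≢j = ≈ᶜ-sym (T~U l l≢j)

  AgreeOff-trans : ∀ {j} {T U V : Triple {n}} → AgreeOff j T U → AgreeOff j U V → AgreeOff j T V
  AgreeOff-trans T~U U~V l l≢j = ≈ᶜ-trans (T~U l l≢j) (U~V l l≢j)

  AgreeOff-patch : ∀ {j c} {T T' U U' : Triple {n}} → AgreeOff j T T' →
    AgreeOff c T U → AgreeOff c T' U' → col c U ≈ᶜ col c U' → AgreeOff j U U'
  AgreeOff-patch {c = c} T~T' T~U T'~U' U≈U' l l≢j with l ≟ c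
  ... | yes refl = U≈U'
  ... | no l≢c = ≈ᶜ-trans (≈ᶜ-sym (T~U l l≢c)) (≈ᶜ-trans (T~T' l l≢j) (T'~U' l l≢c))

  skip-column : (j : Fin n) {T V : Triple {n}} → Reach T V → {T' : Triple {n}} → AgreeOff j T T' → IsDSD T' →
    Σ (Triple {n}) λ V' → Reach T' V' × AgreeOff j V V' × col j V' ≈ᶜ col j T'
  skip-column j done {T'} T~T' _ = T' , done , T~T' , ≈ᶜ-refl
  skip-column j (step s R) T~T' dsd with stepColumn s ≟ j
  ... | yes refl = skip-column j R (AgreeOff-trans (AgreeOff-sym (step-off s)) T~T') dsd
  ... | no c≢j with lift-step (stepColumn s) (Stepᶜ-respˡ (T~T' (stepColumn s) c≢j) (step-on s)) dsd
  ...   | X , s' , X≈U , T'~X with skip-column j R (AgreeOff-patch T~T' (step-off s) T'~X (≈ᶜ-sym X≈U))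
                                                   (step-preserves-DSD s')
  ...     | V' , R' , V~V' , V'≈X = V' , step s' R' , V~V' , ≈ᶜ-trans V'≈X (≈ᶜ-sym (T'~X j (≢-sym c≢j)))

  lift-column : (j : Fin n) {C D : Column} → Reachᶜ C D → {X : Triple {n}} → col j X ≈ᶜ C → IsDSD X →
    Σ (Triple {n}) λ X' → Reach X X' × AgreeOff j X X' × col j X' ≈ᶜ D
  lift-column j (doneᶜ C≈D) {X} X≈C _ = X , done , AgreeOff-refl , ≈ᶜ-trans X≈C C≈D
  lift-column j (stepᶜ s R) X≈C dsd with lift-step j (Stepᶜ-respˡ (≈ᶜ-sym X≈C) s) dsd
  ... | X₁ , s₁ , X₁≈ , X~X₁ with lift-column j R X₁≈ (step-preserves-DSD s₁)
  ...   | X' , R' , X₁~X' , X'≈D = X' , step s₁ R' , AgreeOff-trans X~X₁ X₁~X' , X'≈D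

  Reach⇒Reachᶜ : (j : Fin n) {T V : Triple {n}} → Reach T V → Reachᶜ (col j T) (col j V)
  Reach⇒Reachᶜ j done = doneᶜ ≈ᶜ-refl
  Reach⇒Reachᶜ j (step s R) with stepColumn s ≟ j
  ... | yes refl = stepᶜ (step-on s) (Reach⇒Reachᶜ j R)
  ... | no c≢j = Reachᶜ-respˡ (≈ᶜ-sym (step-off s j (≢-sym c≢j))) (Reach⇒Reachᶜ j R)

  -- The moves of R outside column j are replayed from S', and column j then follows RW.
  replace-column : (j : Fin n) {S S' T : Triple {n}} → AgreeOff j S S' → IsDSD S' → Reach S T →
    {W : Column} → Reachᶜ (col j S') W → diagᶜ W ≗ diagᶜ (col j T) →
    Σ (Triple {n}) λ V → InSBD S' V × (∀ k l → diag V k l ≡ diag T k l)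
  replace-column j {T = T} S~S' dsd R RW W≗T with skip-column j R S~S' dsd
  ... | V₁ , R₁ , T~V₁ , V₁≈S' with lift-column j RW V₁≈S' (reach-preserves-DSD R₁ dsd)
  ...   | V , R₂ , V₁~V , V≈W = V , (R₁ ◅◅ R₂ , reach-preserves-DSD (R₁ ◅◅ R₂) dsd) , agree
    where
    agree : ∀ k l → diag V k l ≡ diag T k l
    agree k l with l ≟ j
    ... | yes refl = trans (proj₁ V≈W k) (W≗T k)
    ... | no l≢j = sym (trans (proj₁ (T~V₁ l l≢j) k) (proj₁ (V₁~V l l≢j) k))

-- Simulating column runs

module _ {n : ℕ} where

  climb : ∀ {y x : Fin n} → Acc _<_ x → (C : Column) → y ≤ x → diagᶜ C x ≡ true →
    (∀ k → y ≤ k → k < x → diagᶜ C k ≡ false) → (∀ k → y ≤ k → k ≤ x → deadᶜ C k ≡ false) →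
    Σ Column λ W → Reachᶜ C W × diagᶜ W ≗ move x y (diagᶜ C)
  climb {y} {x} (acc rec) C y≤x dx empty alive with toSum (x ≟ y)
  ... | inj₁ refl = C , doneᶜ ≈ᶜ-refl , λ k → sym (move-self (diagᶜ C) dx k)
  ... | inj₂ x≢y with F.≤∧≢⇒< y≤x (≢-sym x≢y)
  ...   | y<x with row-above y<x
  ...     | x₋ , x₋⋖x
            with climb (rec (⋖⇒< x₋⋖x)) (bubbled x x₋ C) (⋖-≤-pred x₋⋖x y<x) (move-≡ (diagᶜ C) x x₋)
                   (λ k y≤k k<x₋ → let k<x = F.<-trans k<x₋ (⋖⇒< x₋⋖x) in
                      trans (move-≢ (diagᶜ C) (F.<⇒≢ k<x) (F.<⇒≢ k<x₋)) (empty k y≤k k<x))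
                   (λ k y≤k k≤x₋ → alive k y≤k (F.≤-trans k≤x₋ (ℕ.<⇒≤ (⋖⇒< x₋⋖x))))
  ...       | W , R , W≗ = W , stepᶜ (bubbleᶜ x x₋ x₋⋖x dx (alive x y≤x F.≤-refl) dx₋ ≈ᶜ-refl) R ,
                           λ k → trans (W≗ k) (move-move (diagᶜ C) dx₋ k)
    where
    dx₋ : diagᶜ C x₋ ≡ false
    dx₋ = empty x₋ (⋖-≤-pred x₋⋖x y<x) (⋖⇒< x₋⋖x)

module Simulation {n : ℕ} {S : Set} (Inv : Column {n} → S → Set) (Φ : S → Column {n} → Column {n})
  (simulate-step : ∀ {C U s} → Inv C s → Stepᶜ C U → Σ S λ s' → Inv U s' × Reachᶜ (Φ s C) (Φ s' U))
  (catch-up : ∀ {C s} → Inv C s → Σ (Column {n}) λ W → Reachᶜ (Φ s C) W × diagᶜ W ≗ diagᶜ C) where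

  simulate : ∀ {C V s} → Inv C s → Reachᶜ C V →
    Σ (Column {n}) λ W → Reachᶜ (Φ s C) W × diagᶜ W ≗ diagᶜ V
  simulate inv (doneᶜ C≈V) with catch-up inv
  ... | W , R , W≗C = W , R , λ k → trans (W≗C k) (proj₁ C≈V k)
  simulate inv (stepᶜ s R) with simulate-step inv s
  ... | s' , inv' , R₁ with simulate inv' R
  ...   | W , R₂ , W≗V = W , R₁ ◅◅ᶜ R₂ , W≗V

-- From the lower anchor to the upper one

module _ {n : ℕ} where

  ModeDead : Vector Bool n → Maybe (Fin n) → Set
  ModeDead f nothing = ∀ r → f r ≡ false
  ModeDead f (just m) = f m ≡ true

  -- A run anchored at i, seen in one column C: the anchored square (from i) is at a, the square
  -- from i-1 is at b, the rows between them are empty, and mode records the row of the first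
  -- K-bubble, if any.
  record LowerState (C : Column {n}) (b a a₋ : Fin n) (mode : Maybe (Fin n)) : Set where
    field
      a₋⋖a : a₋ ⋖ a
      anch-a : anchᶜ C a ≡ true
      anch-unique : ∀ r → anchᶜ C r ≡ true → r ≡ a
      diag-a : diagᶜ C a ≡ true
      diag-b : diagᶜ C b ≡ true
      b<a : b < a
      gap-empty : ∀ r → b < r → r < a → diagᶜ C r ≡ false
      dead-below : ∀ r → deadᶜ C r ≡ true → a < r
      mode-dead : ModeDead (deadᶜ C) mode

    a₋<a : a₋ < a
    a₋<a = ⋖⇒< a₋⋖a

    b≤a₋ : b ≤ a₋
    b≤a₋ = ⋖-≤-pred a₋⋖a b<a

    empty-a₋⇒b<a₋ : diagᶜ C a₋ ≡ false → b < a₋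
    empty-a₋⇒b<a₋ da₋ = F.≤∧≢⇒< b≤a₋ λ { refl → not-¬ da₋ diag-b }

    diag-a₋ : b ≢ a₋ → diagᶜ C a₋ ≡ false
    diag-a₋ b≢a₋ = gap-empty a₋ (F.≤∧≢⇒< b≤a₋ b≢a₋) a₋<a

    alive-≤ : ∀ k → k ≤ a → deadᶜ C k ≡ false
    alive-≤ k k≤a = ¬-not λ fk → ℕ.<⇒≱ (dead-below k fk) k≤a

  -- The run anchored at i-1 shadowing it. Before the first K-bubble, its anchor (the square from
  -- i-1) waits at a₋, directly above the square from i at a; afterwards its anchor is at a, and
  -- the square from i stays alive at m, where the run anchored at i has its first dead square.
  -- Either way the square from i-1 still has to climb to b (catch-up).
  upper : Fin n → Fin n → Fin n → Maybe (Fin n) → Column {n} → Column {n}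
  upper b a a₋ nothing C = ⟪ insert a₋ (erase b (diagᶜ C)) , deadᶜ C , only a₋ ⟫
  upper b a a₋ (just m) C = ⟪ erase b (diagᶜ C) , erase m (deadᶜ C) , only a ⟫

  upper-≈ : ∀ {b b' a a₋} mode {C D : Column {n}} →
    erase b (diagᶜ C) ≗ erase b' (diagᶜ D) → deadᶜ C ≗ deadᶜ D →
    upper b a a₋ mode C ≈ᶜ upper b' a a₋ mode D
  upper-≈ nothing d≗ f≗ = insert-cong _ d≗ , f≗ , λ _ → refl
  upper-≈ (just m) d≗ f≗ = d≗ , erase-cong m f≗ , λ _ → refl

  LowerState-resp : ∀ {C D b a a₋ mode} → C ≈ᶜ D → LowerState C b a a₋ mode → LowerState D b a a₋ mode
  LowerState-resp {C} {D} {mode = mode} (d , f , an) inv = record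
    { a₋⋖a = a₋⋖a
    ; anch-a = trans (sym (an _)) anch-a
    ; anch-unique = λ r h → anch-unique r (trans (an r) h)
    ; diag-a = trans (sym (d _)) diag-a
    ; diag-b = trans (sym (d _)) diag-b
    ; b<a = b<a
    ; gap-empty = λ r p q → trans (sym (d r)) (gap-empty r p q)
    ; dead-below = λ r h → dead-below r (trans (f r) h)
    ; mode-dead = mode-resp mode mode-dead
    }
    where
    open LowerState inv
    mode-resp : ∀ mode → ModeDead (deadᶜ C) mode → ModeDead (deadᶜ D) mode
    mode-resp nothing h r = trans (sym (f r)) (h r)
    mode-resp (just m) h = trans (sym (f m)) h

  LowerPos : Set
  LowerPos = Fin n × Fin n × Fin n × Maybe (Fin n)

  Lower : Column {n} → LowerPos → Set
  Lower C (b , a , a₋ , mode) = LowerState C b a a₋ mode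

  upperOf : LowerPos → Column {n} → Column {n}
  upperOf (b , a , a₋ , mode) = upper b a a₋ mode

  Lower-transport : ∀ {U U₀ X : Column {n}} s → U ≈ᶜ U₀ → Lower U₀ s × Reachᶜ X (upperOf s U₀) →
    Σ LowerPos λ s' → Lower U s' × Reachᶜ X (upperOf s' U)
  Lower-transport s@(b , a , a₋ , mode) U≈U₀@(d≗ , f≗ , _) (inv , R) =
    s , LowerState-resp (≈ᶜ-sym U≈U₀) inv ,
    Reachᶜ-respʳ R (upper-≈ mode (erase-cong b (sym ∘ d≗)) (sym ∘ f≗))

  module LowerSteps {C : Column {n}} {b a a₋ : Fin n} {mode : Maybe (Fin n)} (inv : LowerState C b a a₋ mode) where
    open LowerState inv
    open SetoidReasoning (Fin n →-setoid Bool)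

    b≢a : b ≢ a
    b≢a = F.<⇒≢ b<a

    a≢a₋ : a ≢ a₋
    a≢a₋ = ⋖⇒≢ a₋⋖a

    anch-off : ∀ {r} → r ≢ a → anchᶜ C r ≡ false
    anch-off r≢a = ¬-not (r≢a ∘ anch-unique _)

    erased-gap : ∀ k → b ≤ k → k < a → erase b (diagᶜ C) k ≡ false
    erased-gap k b≤k k<a with toSum (k ≟ b)
    ... | inj₁ refl = erase-≡ (diagᶜ C) b
    ... | inj₂ k≢b = trans (erase-≢ (diagᶜ C) k≢b) (gap-empty k (F.≤∧≢⇒< b≤k (≢-sym k≢b)) k<a)

    moved-anchor-unique : ∀ k → move a a₋ (anchᶜ C) k ≡ true → k ≡ a₋
    moved-anchor-unique k h with move⁻ (anchᶜ C) {a} {a₋} {k} h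
    ... | inj₁ k≡a₋ = k≡a₋
    ... | inj₂ (k≢a , ak) = contradiction (anch-unique k ak) k≢a

    b-bubbles : ∀ {r'} → r' ⋖ b → diagᶜ C r' ≡ false →
      LowerState (bubbled b r' C) r' a a₋ mode × upper b a a₋ mode C ≈ᶜ upper r' a a₋ mode (bubbled b r' C)
    b-bubbles {r'} r'⋖b dr' = state , upper-≈ mode (λ k → sym (erase-move (diagᶜ C) dr' k)) (λ _ → refl)
      where
      r'<a = F.<-trans (⋖⇒< r'⋖b) b<a
      anch≗ : anchᶜ (bubbled b r' C) ≗ anchᶜ C
      anch≗ = carry-unmarked (anchᶜ C) (anch-off b≢a)
      gap : ∀ r → r' < r → r < a → move b r' (diagᶜ C) r ≡ false
      gap r r'<r r<a with toSum (r ≟ b)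
      ... | inj₁ refl = move-source (diagᶜ C) (⋖⇒≢ r'⋖b)
      ... | inj₂ r≢b =
        trans (move-≢ (diagᶜ C) r≢b (≢-sym (F.<⇒≢ r'<r))) (gap-empty r (⋖-above r'⋖b r'<r r≢b) r<a)
      state : LowerState (bubbled b r' C) r' a a₋ mode
      state = record
        { a₋⋖a = a₋⋖a
        ; anch-a = trans (anch≗ a) anch-a
        ; anch-unique = λ r h → anch-unique r (trans (sym (anch≗ r)) h)
        ; diag-a = trans (move-≢ (diagᶜ C) (≢-sym b≢a) (≢-sym (F.<⇒≢ r'<a))) diag-a
        ; diag-b = move-≡ (diagᶜ C) b r'
        ; b<a = r'<a
        ; gap-empty = gap
        ; dead-below = dead-below
        ; mode-dead = mode-dead
        }

    module _ {r r' : Fin n} (r'⋖r : r' ⋖ r) (dr : diagᶜ C r ≡ true) (dr' : diagᶜ C r' ≡ false)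
             (r≢a : r ≢ a) (r≢b : r ≢ b) where

      private
        outside : r < b ⊎ a < r
        outside with F.<-cmp r b
        ... | tri< r<b _ _ = inj₁ r<b
        ... | tri≈ _ r≡b _ = contradiction r≡b r≢b
        ... | tri> _ _ b<r with F.<-cmp r a
        ...   | tri< r<a _ _ = contradiction dr (not-¬ (gap-empty r b<r r<a))
        ...   | tri≈ _ r≡a _ = contradiction r≡a r≢a
        ...   | tri> _ _ a<r = inj₂ a<r

        r'≢b : r' ≢ b
        r'≢b refl = not-¬ dr' diag-b

        r≢a₋ : r ≢ a₋
        r≢a₋ refl with outside
        ... | inj₁ r<b = ℕ.<⇒≱ r<b b≤a₋
        ... | inj₂ a<r = F.<-asym a<r a₋<a

        r'≢a₋ : r' ≢ a₋
        r'≢a₋ refl = r≢a (F.toℕ-injective (trans r'⋖r (sym a₋⋖a)))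

        r'∉gap : b < r' → r' < a → ⊥
        r'∉gap b<r' r'<a with outside
        ... | inj₁ r<b = F.<-asym b<r' (F.<-trans (⋖⇒< r'⋖r) r<b)
        ... | inj₂ a<r = ℕ.<⇒≱ r'<a (⋖-≤-pred r'⋖r a<r)

        gap : ∀ k → b < k → k < a → move r r' (diagᶜ C) k ≡ false
        gap k b<k k<a with toSum (k ≟ r) | toSum (k ≟ r')
        ... | inj₁ refl | _ = move-source (diagᶜ C) (⋖⇒≢ r'⋖r)
        ... | inj₂ _ | inj₁ refl = ⊥-elim (r'∉gap b<k k<a)
        ... | inj₂ k≢r | inj₂ k≢r' = trans (move-≢ (diagᶜ C) k≢r k≢r') (gap-empty k b<k k<a)

        anch≗ : anchᶜ (bubbled r r' C) ≗ anchᶜ C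
        anch≗ = carry-unmarked (anchᶜ C) (anch-off r≢a)

      other-bubbles-state : LowerState (bubbled r r' C) b a a₋ mode
      other-bubbles-state = record
        { a₋⋖a = a₋⋖a
        ; anch-a = trans (anch≗ a) anch-a
        ; anch-unique = λ k h → anch-unique k (trans (sym (anch≗ k)) h)
        ; diag-a = trans (move-≢ (diagᶜ C) (≢-sym r≢a) λ { refl → not-¬ dr' diag-a }) diag-a
        ; diag-b = trans (move-≢ (diagᶜ C) (≢-sym r≢b) (≢-sym r'≢b)) diag-b
        ; b<a = b<a
        ; gap-empty = gap
        ; dead-below = dead-below
        ; mode-dead = mode-dead
        }

      other-bubbles-reach : deadᶜ C r ≡ false → ∀ mode →
        Reachᶜ (upper b a a₋ mode C) (upper b a a₋ mode (bubbled r r' C))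
      other-bubbles-reach fr nothing = Stepᶜ⇒Reachᶜ (bubbleᶜ r r' r'⋖r
        (trans (insert-≢ (erase b (diagᶜ C)) r≢a₋) (trans (erase-≢ (diagᶜ C) r≢b) dr)) fr
        (trans (insert-≢ (erase b (diagᶜ C)) r'≢a₋) (trans (erase-≢ (diagᶜ C) r'≢b) dr'))
        ( (λ k → sym (trans (move-insert-comm (erase b (diagᶜ C)) (≢-sym r≢a₋) (≢-sym r'≢a₋) k)
                            (insert-cong a₋ (move-erase-comm (diagᶜ C) (≢-sym r≢b) (≢-sym r'≢b)) k)))
        , (λ _ → refl)
        , (λ k → sym (carry-unmarked (only a₋) (only-≢ r≢a₋) k))))
      other-bubbles-reach fr (just m) = Stepᶜ⇒Reachᶜ (bubbleᶜ r r' r'⋖r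
        (trans (erase-≢ (diagᶜ C) r≢b) dr) (erase-false (deadᶜ C) fr) (trans (erase-≢ (diagᶜ C) r'≢b) dr')
        ( (λ k → sym (move-erase-comm (diagᶜ C) (≢-sym r≢b) (≢-sym r'≢b) k))
        , (λ _ → refl)
        , (λ k → sym (carry-unmarked (only a) (only-≢ r≢a) k))))

    module _ (da₋ : diagᶜ C a₋ ≡ false) {a₋₋ : Fin n} (a₋₋⋖a₋ : a₋₋ ⋖ a₋) where

      private
        b<a₋ = empty-a₋⇒b<a₋ da₋
        b≢a₋ = F.<⇒≢ b<a₋
        a₋≢a₋₋ = ⋖⇒≢ a₋₋⋖a₋
        a₋₋<a = F.<-trans (⋖⇒< a₋₋⋖a₋) a₋<a
        anch≗ : anchᶜ (bubbled a a₋ C) ≗ move a a₋ (anchᶜ C)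
        anch≗ = carry-marked (anchᶜ C) anch-a

      anchor-bubbles-state : LowerState (bubbled a a₋ C) b a₋ a₋₋ mode
      anchor-bubbles-state = record
        { a₋⋖a = a₋₋⋖a₋
        ; anch-a = trans (anch≗ a₋) (move-≡ (anchᶜ C) a a₋)
        ; anch-unique = λ k h → moved-anchor-unique k (trans (sym (anch≗ k)) h)
        ; diag-a = move-≡ (diagᶜ C) a a₋
        ; diag-b = trans (move-≢ (diagᶜ C) b≢a b≢a₋) diag-b
        ; b<a = b<a₋
        ; gap-empty = λ k b<k k<a₋ → trans (move-≢ (diagᶜ C) (F.<⇒≢ (F.<-trans k<a₋ a₋<a)) (F.<⇒≢ k<a₋))
                                           (gap-empty k b<k (F.<-trans k<a₋ a₋<a))
        ; dead-below = λ k fk → F.<-trans a₋<a (dead-below k fk)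
        ; mode-dead = mode-dead
        }

      private
        d₀ = insert a₋ (erase b (diagᶜ C))

        diag-after-two : move a a₋ (move a₋ a₋₋ d₀) ≗ insert a₋₋ (erase b (move a a₋ (diagᶜ C)))
        diag-after-two = begin
          move a a₋ (move a₋ a₋₋ d₀)
            ≈⟨ move-cong a a₋ (move-insert-source (erase b (diagᶜ C))) ⟩
          move a a₋ (move a₋ a₋₋ (erase b (diagᶜ C)))
            ≈⟨ move-cong a a₋ (insert-cong a₋₋ (erase-absent (erase b (diagᶜ C))
                 (trans (erase-≢ (diagᶜ C) (≢-sym b≢a₋)) da₋))) ⟩
          move a a₋ (insert a₋₋ (erase b (diagᶜ C)))
            ≈⟨ move-insert-comm (erase b (diagᶜ C)) (F.<⇒≢ a₋₋<a) (≢-sym a₋≢a₋₋) ⟩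
          insert a₋₋ (move a a₋ (erase b (diagᶜ C)))
            ≈⟨ insert-cong a₋₋ (move-erase-comm (diagᶜ C) b≢a b≢a₋) ⟩
          insert a₋₋ (erase b (move a a₋ (diagᶜ C))) ∎

        anch-after-two : carry a a₋ (carry a₋ a₋₋ (only a₋)) ≗ only a₋₋
        anch-after-two = begin
          carry a a₋ (carry a₋ a₋₋ (only a₋))
            ≈⟨ carry-unmarked _ (trans (carry-marked (only a₋) (only-≡ a₋) a)
                                       (trans (move-only a₋ a₋₋ a) (only-≢ (≢-sym (F.<⇒≢ a₋₋<a))))) ⟩
          carry a₋ a₋₋ (only a₋)  ≈⟨ carry-marked (only a₋) (only-≡ a₋) ⟩
          move a₋ a₋₋ (only a₋)   ≈⟨ move-only a₋ a₋₋ ⟩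
          only a₋₋ ∎

      -- Before the first K-bubble the upper run needs two moves: its anchor, then the square below it.
      anchor-bubbles-reach : ∀ mode → ModeDead (deadᶜ C) mode →
        Reachᶜ (upper b a a₋ mode C) (upper b a₋ a₋₋ mode (bubbled a a₋ C))
      anchor-bubbles-reach nothing no-dead = stepᶜ
        (bubbleᶜ a₋ a₋₋ a₋₋⋖a₋ (insert-≡ (erase b (diagᶜ C)) a₋) (no-dead a₋)
          (trans (insert-≢ (erase b (diagᶜ C)) (≢-sym a₋≢a₋₋))
                 (erased-gap a₋₋ (⋖-≤-pred a₋₋⋖a₋ b<a₋) a₋₋<a))
          ≈ᶜ-refl)
        (Stepᶜ⇒Reachᶜ (bubbleᶜ a a₋ a₋⋖a
          (trans (move-≢ d₀ a≢a₋ (≢-sym (F.<⇒≢ a₋₋<a)))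
                 (trans (insert-≢ (erase b (diagᶜ C)) a≢a₋) (trans (erase-≢ (diagᶜ C) (≢-sym b≢a)) diag-a)))
          (no-dead a) (move-source d₀ a₋≢a₋₋)
          (sym ∘ diag-after-two , (λ _ → refl) , sym ∘ anch-after-two)))
      anchor-bubbles-reach (just m) _ = Stepᶜ⇒Reachᶜ (bubbleᶜ a a₋ a₋⋖a
        (trans (erase-≢ (diagᶜ C) (≢-sym b≢a)) diag-a) (erase-false (deadᶜ C) (alive-≤ a F.≤-refl))
        (trans (erase-≢ (diagᶜ C) (≢-sym b≢a₋)) da₋)
        ( (λ k → sym (move-erase-comm (diagᶜ C) b≢a b≢a₋ k))
        , (λ _ → refl)
        , (λ k → sym (trans (carry-marked (only a) (only-≡ a) k) (move-only a a₋ k)))))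

    anchor-kbubbles : diagᶜ C a₋ ≡ false → ∀ {a₋₋} → a₋₋ ⋖ a₋ →
      LowerState (kbubbled a a₋ C) b a₋ a₋₋ (just (fromMaybe a mode)) ×
      Reachᶜ (upper b a a₋ mode C) (upper b a₋ a₋₋ (just (fromMaybe a mode)) (kbubbled a a₋ C))
    anchor-kbubbles da₋ {a₋₋} a₋₋⋖a₋ = state , reach mode mode-dead
      where
      b<a₋ = empty-a₋⇒b<a₋ da₋
      a₋≢b = ≢-sym (F.<⇒≢ b<a₋)
      below : ∀ k → insert a (deadᶜ C) k ≡ true → a₋ < k
      below k fk with insert⁻ (deadᶜ C) fk
      ... | inj₁ refl = a₋<a
      ... | inj₂ fk' = F.<-trans a₋<a (dead-below k fk')
      first-dead : ∀ mode → ModeDead (deadᶜ C) mode → ModeDead (insert a (deadᶜ C)) (just (fromMaybe a mode))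
      first-dead nothing _ = insert-≡ (deadᶜ C) a
      first-dead (just m) fm = insert⁺ (deadᶜ C) fm
      state : LowerState (kbubbled a a₋ C) b a₋ a₋₋ (just (fromMaybe a mode))
      state = record
        { a₋⋖a = a₋₋⋖a₋
        ; anch-a = move-≡ (anchᶜ C) a a₋
        ; anch-unique = moved-anchor-unique
        ; diag-a = insert-≡ (diagᶜ C) a₋
        ; diag-b = insert⁺ (diagᶜ C) diag-b
        ; b<a = b<a₋
        ; gap-empty = λ k b<k k<a₋ →
            trans (insert-≢ (diagᶜ C) (F.<⇒≢ k<a₋)) (gap-empty k b<k (F.<-trans k<a₋ a₋<a))
        ; dead-below = below
        ; mode-dead = first-dead mode mode-dead
        }
      reach : ∀ mode → ModeDead (deadᶜ C) mode →
        Reachᶜ (upper b a a₋ mode C) (upper b a₋ a₋₋ (just (fromMaybe a mode)) (kbubbled a a₋ C))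
      reach nothing no-dead = doneᶜ
        (insert-erase-comm (diagᶜ C) a₋≢b , (λ k → sym (erase-insert (deadᶜ C) (no-dead a) k)) , λ _ → refl)
      reach (just m) fm = Stepᶜ⇒Reachᶜ (kbubbleᶜ a a₋ a₋⋖a (only-≡ a)
        (trans (erase-≢ (diagᶜ C) a₋≢b) da₋)
        ( (λ k → sym (insert-erase-comm (diagᶜ C) a₋≢b k))
        , (λ k → sym (insert-erase-comm (deadᶜ C) (F.<⇒≢ (dead-below m fm)) k))
        , (λ k → sym (move-only a a₋ k))))

    restore : ∀ {X : Column} → diagᶜ X ≗ insert a₋ (erase b (diagᶜ C)) →
      (∀ k → k ≤ a₋ → deadᶜ X k ≡ false) → Σ Column λ W → Reachᶜ X W × diagᶜ W ≗ diagᶜ C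
    restore {X} X≗ alive
      with climb (<-wellFounded a₋) X b≤a₋ (trans (X≗ a₋) (insert-≡ (erase b (diagᶜ C)) a₋)) empty
                 (λ k _ → alive k)
      where
      empty : ∀ k → b ≤ k → k < a₋ → diagᶜ X k ≡ false
      empty k b≤k k<a₋ =
        trans (X≗ k) (trans (insert-≢ (erase b (diagᶜ C)) (F.<⇒≢ k<a₋))
                            (erased-gap k b≤k (F.<-trans k<a₋ a₋<a)))
    ... | W , R , W≗ = W , R , λ k → trans (W≗ k) (restored k)
      where
      restored : move a₋ b (diagᶜ X) ≗ diagᶜ C
      restored = begin
        move a₋ b (diagᶜ X)                         ≈⟨ move-cong a₋ b X≗ ⟩
        move a₋ b (insert a₋ (erase b (diagᶜ C)))   ≈⟨ move-insert-source (erase b (diagᶜ C)) ⟩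
        move a₋ b (erase b (diagᶜ C))               ≈⟨ move-erase-target (diagᶜ C) diag-b diag-a₋ ⟩
        diagᶜ C ∎

    catch-up : Σ Column λ W → Reachᶜ (upper b a a₋ mode C) W × diagᶜ W ≗ diagᶜ C
    catch-up = from mode mode-dead
      where
      from : ∀ mode → ModeDead (deadᶜ C) mode →
        Σ Column λ W → Reachᶜ (upper b a a₋ mode C) W × diagᶜ W ≗ diagᶜ C
      from nothing no-dead = restore (λ _ → refl) (λ k _ → no-dead k)
      from (just m) _
        with restore {kbubbled a a₋ (upper b a a₋ (just m) C)} (λ _ → refl)
               (λ k k≤a₋ → let k<a = ℕ.≤-<-trans k≤a₋ a₋<a in
                  trans (insert-≢ (erase m (deadᶜ C)) (F.<⇒≢ k<a))
                        (erase-false (deadᶜ C) (alive-≤ k (ℕ.<⇒≤ k<a))))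
      ... | W , R , W≗ =
        W , stepᶜ (kbubbleᶜ a a₋ a₋⋖a (only-≡ a) (erased-gap a₋ b≤a₋ a₋<a) ≈ᶜ-refl) R , W≗

    simulate-step : ∀ {U} → Stepᶜ C U →
      Σ LowerPos λ s' → Lower U s' × Reachᶜ (upper b a a₋ mode C) (upperOf s' U)
    simulate-step (bubbleᶜ r r' r'⋖r dr fr dr' U≈) with toSum (r ≟ a) | toSum (r ≟ b)
    ... | inj₁ refl | _ with ⋖-unique r'⋖r a₋⋖a
    ...   | refl with row-above (empty-a₋⇒b<a₋ dr')
    ...     | a₋₋ , a₋₋⋖a₋ = Lower-transport (b , a₋ , a₋₋ , mode) U≈
                (anchor-bubbles-state dr' a₋₋⋖a₋ , anchor-bubbles-reach dr' a₋₋⋖a₋ mode mode-dead)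
    simulate-step (bubbleᶜ r r' r'⋖r dr fr dr' U≈) | inj₂ r≢a | inj₁ refl =
      Lower-transport (r' , a , a₋ , mode) U≈ (map₂ doneᶜ (b-bubbles r'⋖r dr'))
    simulate-step (bubbleᶜ r r' r'⋖r dr fr dr' U≈) | inj₂ r≢a | inj₂ r≢b =
      Lower-transport (b , a , a₋ , mode) U≈
        (other-bubbles-state r'⋖r dr dr' r≢a r≢b , other-bubbles-reach r'⋖r dr dr' r≢a r≢b fr mode)
    simulate-step (kbubbleᶜ r r' r'⋖r ar dr' U≈) with anch-unique r ar
    ... | refl with ⋖-unique r'⋖r a₋⋖a
    ...   | refl with row-above (empty-a₋⇒b<a₋ dr')
    ...     | a₋₋ , a₋₋⋖a₋ =
                Lower-transport (b , a₋ , a₋₋ , just (fromMaybe a mode)) U≈ (anchor-kbubbles dr' a₋₋⋖a₋)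

  lower-step : ∀ {C U : Column {n}} {s} → Lower C s → Stepᶜ C U →
    Σ LowerPos λ s' → Lower U s' × Reachᶜ (upperOf s C) (upperOf s' U)
  lower-step {s = _ , _ , _ , _} inv = LowerSteps.simulate-step inv

  lower-catch-up : ∀ {C : Column {n}} {s} → Lower C s →
    Σ Column λ W → Reachᶜ (upperOf s C) W × diagᶜ W ≗ diagᶜ C
  lower-catch-up {s = _ , _ , _ , _} inv = LowerSteps.catch-up inv

  module LowerToUpper = Simulation Lower upperOf lower-step lower-catch-up

-- From the upper anchor to the lower one

module _ {n : ℕ} where

  liveᶜ : Column {n} → Vector Bool n
  liveᶜ C k = if deadᶜ C k then false else diagᶜ C k

  liveᶜ-alive : ∀ C {k} → deadᶜ C k ≡ false → liveᶜ C k ≡ diagᶜ C k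
  liveᶜ-alive C fk rewrite fk = refl

  liveᶜ-dead : ∀ C {k} → (diagᶜ C k ≡ true → deadᶜ C k ≡ true) → liveᶜ C k ≡ false
  liveᶜ-dead C {k} dead-if-diag with deadᶜ C k | diagᶜ C k
  ... | true | _ = refl
  ... | false | false = refl
  ... | false | true = contradiction (dead-if-diag refl) λ ()

  liveᶜ-empty : ∀ C {k} → diagᶜ C k ≡ false → liveᶜ C k ≡ false
  liveᶜ-empty C dk = liveᶜ-dead C λ dk' → contradiction dk' (not-¬ dk)

  liveᶜ-bubbled : ∀ C {r r'} → deadᶜ C r ≡ false → deadᶜ C r' ≡ false →
    liveᶜ (bubbled r r' C) ≗ move r r' (liveᶜ C)
  liveᶜ-bubbled C {r} {r'} fr fr' k with k ≟ r' | k ≟ r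
  ... | yes refl | _ rewrite fr' = refl
  ... | no _ | yes refl rewrite fr = refl
  ... | no _ | no _ = refl

  liveᶜ-kbubbled : ∀ C {r r'} → r' ≢ r → deadᶜ C r' ≡ false →
    liveᶜ (kbubbled r r' C) ≗ move r r' (liveᶜ C)
  liveᶜ-kbubbled C {r} {r'} r'≢r fr' k with k ≟ r' | k ≟ r
  ... | yes refl | yes refl = contradiction refl r'≢r
  ... | yes refl | no _ rewrite fr' = refl
  ... | no _ | yes refl = refl
  ... | no _ | no _ = refl

  liveᶜ-cong : ∀ {C D} → C ≈ᶜ D → liveᶜ C ≗ liveᶜ D
  liveᶜ-cong (d , f , _) k rewrite f k | d k = refl

  -- A run anchored at i-1, seen in one column C: the anchor is at z, the unanchored square from i
  -- is at l, and every square strictly between them is dead.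
  record UpperState (C : Column {n}) (z l : Fin n) : Set where
    field
      anch-z : anchᶜ C z ≡ true
      anch-unique : ∀ r → anchᶜ C r ≡ true → r ≡ z
      diag-z : diagᶜ C z ≡ true
      diag-l : diagᶜ C l ≡ true
      alive-l : deadᶜ C l ≡ false
      z<l : z < l
      no-live-between : ∀ r → z < r → r < l → diagᶜ C r ≡ true → deadᶜ C r ≡ true
      dead-between : ∀ r → deadᶜ C r ≡ true → z < r × r < l
      dead⊆diag : ∀ r → deadᶜ C r ≡ true → diagᶜ C r ≡ true

    alive-outside : ∀ r → r ≤ z ⊎ l < r → deadᶜ C r ≡ false
    alive-outside r (inj₁ r≤z) = ¬-not λ fr → ℕ.<⇒≱ (proj₁ (dead-between r fr)) r≤z
    alive-outside r (inj₂ l<r) = ¬-not λ fr → F.<-asym l<r (proj₂ (dead-between r fr))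

    alive-if-empty : ∀ {r} → diagᶜ C r ≡ false → deadᶜ C r ≡ false
    alive-if-empty dr = ¬-not (not-¬ dr ∘ dead⊆diag _)

  -- The run anchored at i shadowing it anchors the square at l and never K-bubbles, so it lacks
  -- the dead squares of C; at the end its anchor climbs towards z, K-bubbling exactly at the rows
  -- where C has a square (refill).
  lower : Fin n → Column {n} → Column {n}
  lower l C = ⟪ liveᶜ C , none , only l ⟫

  UpperState-resp : ∀ {C D z l} → C ≈ᶜ D → UpperState C z l → UpperState D z l
  UpperState-resp (d , f , an) inv = record
    { anch-z = trans (sym (an _)) anch-z
    ; anch-unique = λ r h → anch-unique r (trans (an r) h)
    ; diag-z = trans (sym (d _)) diag-z
    ; diag-l = trans (sym (d _)) diag-l
    ; alive-l = trans (sym (f _)) alive-l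
    ; z<l = z<l
    ; no-live-between = λ r p q h → trans (sym (f r)) (no-live-between r p q (trans (d r) h))
    ; dead-between = λ r h → dead-between r (trans (f r) h)
    ; dead⊆diag = λ r h → trans (sym (d r)) (dead⊆diag r (trans (f r) h))
    }
    where open UpperState inv

  lower-bubble : ∀ (C U : Column {n}) {l l' r r'} → r' ⋖ r → liveᶜ C r ≡ true → liveᶜ C r' ≡ false →
    liveᶜ U ≗ move r r' (liveᶜ C) → carry r r' (only l) ≗ only l' → Stepᶜ (lower l C) (lower l' U)
  lower-bubble C U {r = r} {r'} r'⋖r lr lr' live≗ anch≗ =
    bubbleᶜ r r' r'⋖r lr refl lr' (live≗ , (λ _ → refl) , sym ∘ anch≗)

  UpperPos : Set
  UpperPos = Fin n × Fin n

  Upper : Column {n} → UpperPos → Set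
  Upper C (z , l) = UpperState C z l

  lowerOf : UpperPos → Column {n} → Column {n}
  lowerOf (_ , l) = lower l

  Upper-transport : ∀ {U U₀ X : Column {n}} s → U ≈ᶜ U₀ → Upper U₀ s × Stepᶜ X (lowerOf s U₀) →
    Σ UpperPos λ s' → Upper U s' × Reachᶜ X (lowerOf s' U)
  Upper-transport s@(_ , l) U≈U₀ (inv , st) =
    s , UpperState-resp (≈ᶜ-sym U≈U₀) inv ,
    Reachᶜ-respʳ (Stepᶜ⇒Reachᶜ st) (liveᶜ-cong (≈ᶜ-sym U≈U₀) , (λ _ → refl) , (λ _ → refl))

  module UpperSteps {C : Column {n}} {z l : Fin n} (inv : UpperState C z l) where
    open UpperState inv

    alive-z : deadᶜ C z ≡ false
    alive-z = alive-outside z (inj₁ F.≤-refl)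

    live-z : liveᶜ C z ≡ true
    live-z = trans (liveᶜ-alive C alive-z) diag-z

    z≢l : z ≢ l
    z≢l = F.<⇒≢ z<l

    anch-off : ∀ {r} → r ≢ z → anchᶜ C r ≡ false
    anch-off r≢z = ¬-not (r≢z ∘ anch-unique _)

    moved-anchor-unique : ∀ {z₋} k → move z z₋ (anchᶜ C) k ≡ true → k ≡ z₋
    moved-anchor-unique {z₋} k h with move⁻ (anchᶜ C) {z} {z₋} {k} h
    ... | inj₁ k≡z₋ = k≡z₋
    ... | inj₂ (k≢z , ak) = contradiction (anch-unique k ak) k≢z

    z-bubbles : ∀ {z₋} → z₋ ⋖ z → diagᶜ C z₋ ≡ false →
      UpperState (bubbled z z₋ C) z₋ l × Stepᶜ (lower l C) (lower l (bubbled z z₋ C))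
    z-bubbles {z₋} z₋⋖z dz₋ =
      state , lower-bubble C (bubbled z z₋ C) z₋⋖z live-z (liveᶜ-empty C dz₋)
                (liveᶜ-bubbled C alive-z (alive-if-empty dz₋))
                (carry-unmarked (only l) (only-≢ z≢l))
      where
      z₋<z = ⋖⇒< z₋⋖z
      z₋<l = F.<-trans z₋<z z<l
      anch≗ : anchᶜ (bubbled z z₋ C) ≗ move z z₋ (anchᶜ C)
      anch≗ = carry-marked (anchᶜ C) anch-z
      between : ∀ r → z₋ < r → r < l → move z z₋ (diagᶜ C) r ≡ true → deadᶜ C r ≡ true
      between r z₋<r r<l h with move⁻ (diagᶜ C) {z} {z₋} {r} h
      ... | inj₁ refl = contradiction refl (F.<⇒≢ z₋<r)
      ... | inj₂ (r≢z , dr) = no-live-between r (⋖-above z₋⋖z z₋<r r≢z) r<l dr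
      state : UpperState (bubbled z z₋ C) z₋ l
      state = record
        { anch-z = trans (anch≗ z₋) (move-≡ (anchᶜ C) z z₋)
        ; anch-unique = λ k h → moved-anchor-unique k (trans (sym (anch≗ k)) h)
        ; diag-z = move-≡ (diagᶜ C) z z₋
        ; diag-l = trans (move-≢ (diagᶜ C) (≢-sym z≢l) (≢-sym (F.<⇒≢ z₋<l))) diag-l
        ; alive-l = alive-l
        ; z<l = z₋<l
        ; no-live-between = between
        ; dead-between = λ r fr → F.<-trans z₋<z (proj₁ (dead-between r fr)) , proj₂ (dead-between r fr)
        ; dead⊆diag = λ r fr → move⁺ (diagᶜ C) (dead⊆diag r fr) λ { refl → not-¬ alive-z fr }
        }

    z-kbubbles : ∀ {z₋} → z₋ ⋖ z → diagᶜ C z₋ ≡ false →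
      UpperState (kbubbled z z₋ C) z₋ l × Stepᶜ (lower l C) (lower l (kbubbled z z₋ C))
    z-kbubbles {z₋} z₋⋖z dz₋ =
      state , lower-bubble C (kbubbled z z₋ C) z₋⋖z live-z (liveᶜ-empty C dz₋)
                (liveᶜ-kbubbled C (≢-sym (⋖⇒≢ z₋⋖z)) (alive-if-empty dz₋))
                (carry-unmarked (only l) (only-≢ z≢l))
      where
      z₋<z = ⋖⇒< z₋⋖z
      between : ∀ k → z₋ < k → k < l → insert z₋ (diagᶜ C) k ≡ true → insert z (deadᶜ C) k ≡ true
      between k z₋<k k<l h with toSum (k ≟ z)
      ... | inj₁ refl = insert-≡ (deadᶜ C) k
      ... | inj₂ k≢z = insert⁺ (deadᶜ C) (no-live-between k (⋖-above z₋⋖z z₋<k k≢z) k<l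
                         (trans (sym (insert-≢ (diagᶜ C) (≢-sym (F.<⇒≢ z₋<k)))) h))
      dead-between' : ∀ k → insert z (deadᶜ C) k ≡ true → z₋ < k × k < l
      dead-between' k fk with insert⁻ (deadᶜ C) {z} {k} fk
      ... | inj₁ refl = z₋<z , z<l
      ... | inj₂ fk' = F.<-trans z₋<z (proj₁ (dead-between k fk')) , proj₂ (dead-between k fk')
      dead⊆diag' : ∀ k → insert z (deadᶜ C) k ≡ true → insert z₋ (diagᶜ C) k ≡ true
      dead⊆diag' k fk with insert⁻ (deadᶜ C) {z} {k} fk
      ... | inj₁ refl = insert⁺ (diagᶜ C) diag-z
      ... | inj₂ fk' = insert⁺ (diagᶜ C) (dead⊆diag k fk')
      state : UpperState (kbubbled z z₋ C) z₋ l
      state = record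
        { anch-z = move-≡ (anchᶜ C) z z₋
        ; anch-unique = moved-anchor-unique
        ; diag-z = insert-≡ (diagᶜ C) z₋
        ; diag-l = insert⁺ (diagᶜ C) diag-l
        ; alive-l = trans (insert-≢ (deadᶜ C) (≢-sym z≢l)) alive-l
        ; z<l = F.<-trans z₋<z z<l
        ; no-live-between = between
        ; dead-between = dead-between'
        ; dead⊆diag = dead⊆diag'
        }

    l-bubbles : ∀ {l₋} → l₋ ⋖ l → diagᶜ C l₋ ≡ false →
      UpperState (bubbled l l₋ C) z l₋ × Stepᶜ (lower l C) (lower l₋ (bubbled l l₋ C))
    l-bubbles {l₋} l₋⋖l dl₋ =
      state , lower-bubble C (bubbled l l₋ C) l₋⋖l (trans (liveᶜ-alive C alive-l) diag-l) (liveᶜ-empty C dl₋)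
                (liveᶜ-bubbled C alive-l fl₋)
                (λ k → trans (carry-marked (only l) (only-≡ l) k) (move-only l l₋ k))
      where
      l₋<l = ⋖⇒< l₋⋖l
      fl₋ = alive-if-empty dl₋
      z≢l₋ : z ≢ l₋
      z≢l₋ refl = not-¬ dl₋ diag-z
      anch≗ : anchᶜ (bubbled l l₋ C) ≗ anchᶜ C
      anch≗ = carry-unmarked (anchᶜ C) (anch-off (≢-sym z≢l))
      between : ∀ r → z < r → r < l₋ → move l l₋ (diagᶜ C) r ≡ true → deadᶜ C r ≡ true
      between r z<r r<l₋ h = no-live-between r z<r r<l
        (trans (sym (move-≢ (diagᶜ C) (F.<⇒≢ r<l) (F.<⇒≢ r<l₋))) h)
        where r<l = F.<-trans r<l₋ l₋<l
      state : UpperState (bubbled l l₋ C) z l₋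
      state = record
        { anch-z = trans (anch≗ z) anch-z
        ; anch-unique = λ k h → anch-unique k (trans (sym (anch≗ k)) h)
        ; diag-z = trans (move-≢ (diagᶜ C) z≢l z≢l₋) diag-z
        ; diag-l = move-≡ (diagᶜ C) l l₋
        ; alive-l = fl₋
        ; z<l = F.≤∧≢⇒< (⋖-≤-pred l₋⋖l z<l) z≢l₋
        ; no-live-between = between
        ; dead-between = λ r fr → proj₁ (dead-between r fr) ,
                                   ⋖-below l₋⋖l (proj₂ (dead-between r fr)) λ { refl → not-¬ fl₋ fr }
        ; dead⊆diag = λ r fr → move⁺ (diagᶜ C) (dead⊆diag r fr) λ { refl → not-¬ alive-l fr }
        }

    other-bubbles : ∀ {r r'} → r' ⋖ r → diagᶜ C r ≡ true → deadᶜ C r ≡ false → diagᶜ C r' ≡ false →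
      r ≢ z → r ≢ l → UpperState (bubbled r r' C) z l × Stepᶜ (lower l C) (lower l (bubbled r r' C))
    other-bubbles {r} {r'} r'⋖r dr fr dr' r≢z r≢l =
      state , lower-bubble C (bubbled r r' C) r'⋖r (trans (liveᶜ-alive C fr) dr) (liveᶜ-empty C dr')
                (liveᶜ-bubbled C fr (alive-if-empty dr'))
                (carry-unmarked (only l) (only-≢ r≢l))
      where
      outside : r < z ⊎ l < r
      outside with F.<-cmp r z
      ... | tri< r<z _ _ = inj₁ r<z
      ... | tri≈ _ r≡z _ = contradiction r≡z r≢z
      ... | tri> _ _ z<r with F.<-cmp r l
      ...   | tri< r<l _ _ = contradiction (no-live-between r z<r r<l dr) (not-¬ fr)
      ...   | tri≈ _ r≡l _ = contradiction r≡l r≢l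
      ...   | tri> _ _ l<r = inj₂ l<r
      r'∉between : z < r' → r' < l → ⊥
      r'∉between z<r' r'<l with outside
      ... | inj₁ r<z = F.<-asym z<r' (F.<-trans (⋖⇒< r'⋖r) r<z)
      ... | inj₂ l<r = ℕ.<⇒≱ r'<l (⋖-≤-pred r'⋖r l<r)
      anch≗ : anchᶜ (bubbled r r' C) ≗ anchᶜ C
      anch≗ = carry-unmarked (anchᶜ C) (anch-off r≢z)
      between : ∀ k → z < k → k < l → move r r' (diagᶜ C) k ≡ true → deadᶜ C k ≡ true
      between k z<k k<l h with move⁻ (diagᶜ C) {r} {r'} {k} h
      ... | inj₁ refl = ⊥-elim (r'∉between z<k k<l)
      ... | inj₂ (_ , dk) = no-live-between k z<k k<l dk
      state : UpperState (bubbled r r' C) z l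
      state = record
        { anch-z = trans (anch≗ z) anch-z
        ; anch-unique = λ k h → anch-unique k (trans (sym (anch≗ k)) h)
        ; diag-z = trans (move-≢ (diagᶜ C) (≢-sym r≢z) λ { refl → not-¬ dr' diag-z }) diag-z
        ; diag-l = trans (move-≢ (diagᶜ C) (≢-sym r≢l) λ { refl → not-¬ dr' diag-l }) diag-l
        ; alive-l = alive-l
        ; z<l = z<l
        ; no-live-between = between
        ; dead-between = dead-between
        ; dead⊆diag = λ k fk → move⁺ (diagᶜ C) (dead⊆diag k fk) λ { refl → not-¬ fr fk }
        }

    simulate-step : ∀ {U} → Stepᶜ C U → Σ UpperPos λ s' → Upper U s' × Reachᶜ (lower l C) (lowerOf s' U)
    simulate-step (bubbleᶜ r r' r'⋖r dr fr dr' U≈) with toSum (r ≟ z) | toSum (r ≟ l)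
    ... | inj₁ refl | _ = Upper-transport (r' , l) U≈ (z-bubbles r'⋖r dr')
    ... | inj₂ _ | inj₁ refl = Upper-transport (z , r') U≈ (l-bubbles r'⋖r dr')
    ... | inj₂ r≢z | inj₂ r≢l = Upper-transport (z , l) U≈ (other-bubbles r'⋖r dr fr dr' r≢z r≢l)
    simulate-step (kbubbleᶜ r r' r'⋖r ar dr' U≈) with anch-unique r ar
    ... | refl = Upper-transport (r' , l) U≈ (z-kbubbles r'⋖r dr')

  upper-step : ∀ {C U : Column {n}} {s} → Upper C s → Stepᶜ C U →
    Σ UpperPos λ s' → Upper U s' × Reachᶜ (lowerOf s C) (lowerOf s' U)
  upper-step {s = _ , _} inv = UpperSteps.simulate-step inv

  module Refill (target : Vector Bool n) (z : Fin n) where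

    record Refilling (X : Column {n}) (q : Fin n) : Set where
      field
        anch-q : anchᶜ X q ≡ true
        diag-q : diagᶜ X q ≡ true
        alive-q : deadᶜ X q ≡ false
        cleared : ∀ k → z < k → k < q → diagᶜ X k ≡ false × deadᶜ X k ≡ false
        agrees : ∀ k → k ≤ z ⊎ q < k → diagᶜ X k ≡ target k
        target-in : Σ (Fin n) λ k → z < k × k ≤ q × target k ≡ true

    Pending : Fin n → Fin n → Set
    Pending q r = z < r × r < q × target r ≡ true

    module _ {X : Column {n}} {q : Fin n} (fill : Refilling X q) (none : ¬ Σ (Fin n) (Pending q)) where
      open Refilling fill

      target-q : target q ≡ true
      target-q with target-in
      ... | k₀ , z<k₀ , k₀≤q , tk₀ with toSum (k₀ ≟ q)
      ...   | inj₁ refl = tk₀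
      ...   | inj₂ k₀≢q = contradiction (k₀ , z<k₀ , F.≤∧≢⇒< k₀≤q k₀≢q , tk₀) none

      refilled : diagᶜ X ≗ target
      refilled k with F.<-cmp q k
      ... | tri< q<k _ _ = agrees k (inj₂ q<k)
      ... | tri≈ _ refl _ = trans diag-q (sym target-q)
      ... | tri> _ _ k<q with F.<-cmp z k
      ...   | tri< z<k _ _ = trans (proj₁ (cleared k z<k k<q)) (sym (¬-not λ tk → none (k , z<k , k<q , tk)))
      ...   | tri≈ _ refl _ = agrees k (inj₁ F.≤-refl)
      ...   | tri> _ _ k<z = agrees k (inj₁ (ℕ.<⇒≤ k<z))

    pending? : ∀ q r → Dec (Pending q r)
    pending? q r = (z F.<? r) ×-dec (r F.<? q) ×-dec (target r ≟ᵇ true)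

    module _ {X : Column {n}} {q r q₋ : Fin n} (fill : Refilling X q) (pending : Pending q r)
             (q₋⋖q : q₋ ⋖ q) where
      open Refilling fill

      private
        q₋<q = ⋖⇒< q₋⋖q
        r≤q₋ = ⋖-≤-pred q₋⋖q (proj₁ (proj₂ pending))
        z<q₋ = ℕ.<-≤-trans (proj₁ pending) r≤q₋
        q₋≢q = ≢-sym (⋖⇒≢ q₋⋖q)

      cleared-q₋ : diagᶜ X q₋ ≡ false × deadᶜ X q₋ ≡ false
      cleared-q₋ = cleared q₋ z<q₋ q₋<q

      refill-kbubble : target q ≡ true → Refilling (kbubbled q q₋ X) q₋
      refill-kbubble tq = record
        { anch-q = move-≡ (anchᶜ X) q q₋
        ; diag-q = insert-≡ (diagᶜ X) q₋
        ; alive-q = trans (insert-≢ (deadᶜ X) q₋≢q) (proj₂ cleared-q₋)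
        ; cleared = λ k z<k k<q₋ →
            trans (insert-≢ (diagᶜ X) (F.<⇒≢ k<q₋)) (proj₁ (cleared k z<k (F.<-trans k<q₋ q₋<q))) ,
            trans (insert-≢ (deadᶜ X) (F.<⇒≢ (F.<-trans k<q₋ q₋<q)))
                  (proj₂ (cleared k z<k (F.<-trans k<q₋ q₋<q)))
        ; agrees = agrees'
        ; target-in = _ , proj₁ pending , r≤q₋ , proj₂ (proj₂ pending)
        }
        where
        agrees' : ∀ k → k ≤ z ⊎ q₋ < k → insert q₋ (diagᶜ X) k ≡ target k
        agrees' k (inj₁ k≤z) =
          trans (insert-≢ (diagᶜ X) λ { refl → ℕ.<⇒≱ z<q₋ k≤z }) (agrees k (inj₁ k≤z))
        agrees' k (inj₂ q₋<k) with toSum (k ≟ q)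
        ... | inj₁ refl = trans (insert-≢ (diagᶜ X) (⋖⇒≢ q₋⋖q)) (trans diag-q (sym tq))
        ... | inj₂ k≢q =
          trans (insert-≢ (diagᶜ X) (≢-sym (F.<⇒≢ q₋<k))) (agrees k (inj₂ (⋖-above q₋⋖q q₋<k k≢q)))

      refill-bubble : target q ≡ false → Refilling (bubbled q q₋ X) q₋
      refill-bubble tq = record
        { anch-q = trans (carry-marked (anchᶜ X) anch-q q₋) (move-≡ (anchᶜ X) q q₋)
        ; diag-q = move-≡ (diagᶜ X) q q₋
        ; alive-q = proj₂ cleared-q₋
        ; cleared = λ k z<k k<q₋ →
            trans (move-≢ (diagᶜ X) (F.<⇒≢ (F.<-trans k<q₋ q₋<q)) (F.<⇒≢ k<q₋))
                  (proj₁ (cleared k z<k (F.<-trans k<q₋ q₋<q))) ,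
            proj₂ (cleared k z<k (F.<-trans k<q₋ q₋<q))
        ; agrees = agrees'
        ; target-in = _ , proj₁ pending , r≤q₋ , proj₂ (proj₂ pending)
        }
        where
        agrees' : ∀ k → k ≤ z ⊎ q₋ < k → move q q₋ (diagᶜ X) k ≡ target k
        agrees' k (inj₁ k≤z) =
          trans (move-≢ (diagᶜ X) (λ { refl → ℕ.<⇒≱ (F.<-trans z<q₋ q₋<q) k≤z })
                                  (λ { refl → ℕ.<⇒≱ z<q₋ k≤z }))
                (agrees k (inj₁ k≤z))
        agrees' k (inj₂ q₋<k) with toSum (k ≟ q)
        ... | inj₁ refl = trans (move-source (diagᶜ X) (⋖⇒≢ q₋⋖q)) (sym tq)
        ... | inj₂ k≢q =
          trans (move-≢ (diagᶜ X) k≢q (≢-sym (F.<⇒≢ q₋<k))) (agrees k (inj₂ (⋖-above q₋⋖q q₋<k k≢q)))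

    refill : ∀ {X q} → Acc _<_ q → Refilling X q → Σ Column λ W → Reachᶜ X W × diagᶜ W ≗ target
    refill {X} {q} (acc rec) fill with F.any? (pending? q)
    ... | no none = X , doneᶜ ≈ᶜ-refl , refilled fill none
    ... | yes (r , pending) with row-above (proj₁ (proj₂ pending))
    ...   | q₋ , q₋⋖q with target q in tq
    ...     | true with refill (rec (⋖⇒< q₋⋖q)) (refill-kbubble fill pending q₋⋖q tq)
    ...       | W , R , W≗ =
                W , stepᶜ (kbubbleᶜ q q₋ q₋⋖q (Refilling.anch-q fill) (proj₁ (cleared-q₋ fill pending q₋⋖q))
                             ≈ᶜ-refl) R , W≗
    refill {X} {q} (acc rec) fill | yes (r , pending) | q₋ , q₋⋖q | false
      with refill (rec (⋖⇒< q₋⋖q)) (refill-bubble fill pending q₋⋖q tq)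
    ... | W , R , W≗ =
          W , stepᶜ (bubbleᶜ q q₋ q₋⋖q (Refilling.diag-q fill) (Refilling.alive-q fill)
                      (proj₁ (cleared-q₋ fill pending q₋⋖q)) ≈ᶜ-refl) R , W≗

  upper-catch-up : ∀ {C : Column {n}} {s} → Upper C s →
    Σ Column λ W → Reachᶜ (lowerOf s C) W × diagᶜ W ≗ diagᶜ C
  upper-catch-up {C} {z , l} inv = Refill.refill (diagᶜ C) z (<-wellFounded l) (record
    { anch-q = only-≡ l
    ; diag-q = trans (liveᶜ-alive C alive-l) diag-l
    ; alive-q = refl
    ; cleared = λ k z<k k<l → liveᶜ-dead C (no-live-between k z<k k<l) , refl
    ; agrees = λ k outside → liveᶜ-alive C (alive-outside k outside)
    ; target-in = l , z<l , F.≤-refl , diag-l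
    })
    where open UpperState inv

  module UpperToLower = Simulation Upper lowerOf upper-step upper-catch-up

module _ {n : ℕ} where

  module _ {d : Vector Bool n} {i i₋ : Fin n} (i₋⋖i : i₋ ⋖ i) (di : d i ≡ true) (di₋ : d i₋ ≡ true) where

    raise-anchor : ∀ {V} → Reachᶜ ⟪ d , none , only i ⟫ V →
      Σ Column λ W → Reachᶜ ⟪ d , none , only i₋ ⟫ W × diagᶜ W ≗ diagᶜ V
    raise-anchor R with LowerToUpper.simulate {s = i₋ , i , i₋ , nothing} start R
      where
      start : LowerState ⟪ d , none , only i ⟫ i₋ i i₋ nothing
      start = record
        { a₋⋖a = i₋⋖i
        ; anch-a = only-≡ i
        ; anch-unique = λ _ → only⁻
        ; diag-a = di
        ; diag-b = di₋
        ; b<a = ⋖⇒< i₋⋖i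
        ; gap-empty = λ _ i₋<r r<i → ⊥-elim (⋖-gap i₋⋖i i₋<r r<i)
        ; dead-below = λ _ ()
        ; mode-dead = λ _ → refl
        }
    ... | W , R' , W≗ = W , Reachᶜ-respˡ (move-self d di₋ , (λ _ → refl) , (λ _ → refl)) R' , W≗

    lower-anchor : ∀ {V} → Reachᶜ ⟪ d , none , only i₋ ⟫ V →
      Σ Column λ W → Reachᶜ ⟪ d , none , only i ⟫ W × diagᶜ W ≗ diagᶜ V
    lower-anchor = UpperToLower.simulate {s = i₋ , i} start
      where
      start : UpperState ⟪ d , none , only i₋ ⟫ i₋ i
      start = record
        { anch-z = only-≡ i₋
        ; anch-unique = λ _ → only⁻
        ; diag-z = di₋
        ; diag-l = di
        ; alive-l = refl
        ; z<l = ⋖⇒< i₋⋖i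
        ; no-live-between = λ _ i₋<r r<i → ⊥-elim (⋖-gap i₋⋖i i₋<r r<i)
        ; dead-between = λ _ ()
        ; dead⊆diag = λ _ ()
        }

-- Moving the anchor of column j one row up

module AnchorRaise {n : ℕ} (D A : Diagram n) (A⊆D : A ⊆D D) (A-columns : AtMostOnePerColumn A)
                  {i i₋ j : Fin n} (i₋⋖i : i₋ ⋖ i) (ij∈A : (i , j) ∈D A) (i₋j∈D : (i₋ , j) ∈D D) where

  A' : Diagram n
  A' = replaceSq (i , j) (i₋ , j) A

  A'⊆D : A' ⊆D D
  A'⊆D k c h with replaceSq⁻ {p = i} {q = i₋} {c = j} A {k} {c} h
  ... | inj₁ (refl , refl) = i₋j∈D
  ... | inj₂ kc∈A = A⊆D k c kc∈A

  start-DSD : ∀ {B} → B ⊆D D → IsDSD ⟨ D , emptyD , B ⟩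
  start-DSD B⊆D = (λ _ _ ()) , (λ k c h → B⊆D k c h , λ ()) , (λ _ _ ())

  A~A' : AgreeOff j ⟨ D , emptyD , A ⟩ ⟨ D , emptyD , A' ⟩
  A~A' l l≢j = (λ _ → refl) , (λ _ → refl) , λ k → sym (replaceSq-off A l≢j)

  column-A : col j ⟨ D , emptyD , A ⟩ ≈ᶜ ⟪ (λ k → D k j) , none , only i ⟫
  column-A = (λ _ → refl) , (λ _ → refl) , anch≗
    where
    anch≗ : (λ k → A k j) ≗ only i
    anch≗ k with toSum (k ≟ i)
    ... | inj₁ refl = trans ij∈A (sym (only-≡ k))
    ... | inj₂ k≢i = trans (¬-not λ kj∈A → k≢i (A-columns k i j kj∈A ij∈A)) (sym (only-≢ k≢i))

  column-A' : col j ⟨ D , emptyD , A' ⟩ ≈ᶜ ⟪ (λ k → D k j) , none , only i₋ ⟫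
  column-A' = (λ _ → refl) , (λ _ → refl) , λ k →
    trans (replaceSq-on i i₋ j A k) (trans (move-cong i i₋ (proj₂ (proj₂ column-A)) k) (move-only i i₋ k))

  SBD-raise : ∀ E → SBDDiagram ⟨ D , emptyD , A ⟩ E → SBDDiagram ⟨ D , emptyD , A' ⟩ E
  SBD-raise E (T , (R , _) , T≗E)
    with raise-anchor i₋⋖i (A⊆D i j ij∈A) i₋j∈D (Reachᶜ-respˡ column-A (Reach⇒Reachᶜ j R))
  ... | W , RW , W≗ with replace-column j A~A' (start-DSD A'⊆D) R (Reachᶜ-respˡ (≈ᶜ-sym column-A') RW) W≗
  ...   | V , V∈SBD , V≗T = V , V∈SBD , λ k l → trans (V≗T k l) (T≗E k l)

  SBD-lower : ∀ E → SBDDiagram ⟨ D , emptyD , A' ⟩ E → SBDDiagram ⟨ D , emptyD , A ⟩ E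
  SBD-lower E (T , (R , _) , T≗E)
    with lower-anchor i₋⋖i (A⊆D i j ij∈A) i₋j∈D (Reachᶜ-respˡ column-A' (Reach⇒Reachᶜ j R))
  ... | W , RW , W≗
    with replace-column j (AgreeOff-sym A~A') (start-DSD A⊆D) R (Reachᶜ-respˡ (≈ᶜ-sym column-A) RW) W≗
  ...   | V , V∈SBD , V≗T = V , V∈SBD , λ k l → trans (V≗T k l) (T≗E k l)

  Dtop-raise : ∀ r c → InDtop D A r c → InDtop D A' r c
  Dtop-raise r c (inj₁ rc∈D) = inj₁ rc∈D
  Dtop-raise r c (inj₂ (i' , r<i' , i'c∈A)) with toSum (i' ≟ i) | toSum (c ≟ j)
  ... | inj₁ refl | inj₁ refl with toSum (r ≟ i₋)
  ...   | inj₁ refl = inj₁ i₋j∈D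
  ...   | inj₂ r≢i₋ =
    inj₂ (i₋ , ⋖-below i₋⋖i r<i' r≢i₋ , trans (replaceSq-on i i₋ j A i₋) (move-≡ (λ k → A k j) i i₋))
  Dtop-raise r c (inj₂ (i' , r<i' , i'c∈A)) | inj₁ refl | inj₂ c≢j =
    inj₂ (i' , r<i' , replaceSq⁺ {p = i} {q = i₋} {c = j} A i'c∈A (inj₂ c≢j))
  Dtop-raise r c (inj₂ (i' , r<i' , i'c∈A)) | inj₂ i'≢i | _ =
    inj₂ (i' , r<i' , replaceSq⁺ {p = i} {q = i₋} {c = j} A i'c∈A (inj₁ i'≢i))

  Dtop-lower : ∀ r c → InDtop D A' r c → InDtop D A r c
  Dtop-lower r c (inj₁ rc∈D) = inj₁ rc∈D
  Dtop-lower r c (inj₂ (i' , r<i' , i'c∈A')) with replaceSq⁻ {p = i} {q = i₋} {c = j} A {i'} {c} i'c∈A'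
  ... | inj₁ (refl , refl) = inj₂ (i , F.<-trans r<i' (⋖⇒< i₋⋖i) , ij∈A)
  ... | inj₂ i'c∈A = inj₂ (i' , r<i' , i'c∈A)

lemma4p7 : (n : ℕ) (w : Permutation′ n) → Vexillary w →
    (A : Diagram n) → A ⊆D rothe w → AtMostOnePerColumn A →
    (i i₋ j : Fin n) → toℕ i ≡ suc (toℕ i₋) →
    (i , j) ∈D A → (i₋ , j) ∈D rothe w →
    (∀ (D : Diagram n) →
       SBDDiagram ⟨ rothe w , emptyD , A ⟩ D
       ⇔ SBDDiagram ⟨ rothe w , emptyD , replaceSq (i , j) (i₋ , j) A ⟩ D)
    × (∀ (r c : Fin n) →
       InDtop (rothe w) A r c ⇔ InDtop (rothe w) (replaceSq (i , j) (i₋ , j) A) r c)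
lemma4p7 n w _ A A⊆D A-columns i i₋ j i₋⋖i ij∈A i₋j∈D =
  (λ E → mk⇔ (SBD-raise E) (SBD-lower E)) , (λ r c → mk⇔ (Dtop-raise r c) (Dtop-lower r c))
  where open AnchorRaise (rothe w) A A⊆D A-columns i₋⋖i ij∈A i₋j∈D
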